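{- Let $k\ge1$. Let $e_1,\dots,e_k$ be integers such that $e_1,e_2+1,\dots,e_k+k-1$ are distinct nonnegative integers, and let $f_1,\dots,f_k$ be integers such that $f_1,f_2+1,\dots,f_k+k-1$ are distinct and form a subset of $\{0,1,\dots,2k-1\}$. Let $c_1<c_2<\dots<c_k$ be the elements of the complementary subset $\{0,1,\dots,2k-1\}\setminus\{f_i+i-1:1\le i\le k\}$. Let $M$ be the $2k\times2k$ matrix with entries, for $1\le i\le k$, $1\le j\le 2k$, $$M_{i,j}=\frac{1}{\Gamma(2k-i-j+2-e_i)},\qquad M_{k+i,j}=\frac{(-1)^{i+j-1}}{\Gamma(2k-i-j+2-f_i)},$$ with the convention $1/\Gamma(m)=0$ for $m\in\{0,-1,-2,\dots\}$. Then $$\det M=\operatorname{sgn}(f)\left(\prod_{l=0}^{k-1}\frac{(e_{l+1}+l)!\,(f_{l+1}+l)!}{l!\,(k+l)!}2^{c_{l+1}-e_{l+1}-l}\right)\det\left(\binom{c_j}{e_i+i-1}\right)_{1\le i,j\le k}.$$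
   Context: $\operatorname{sgn}(f)$ denotes $(-1)$ raised to the number of transpositions needed to sort $f_1+1,f_2+2,\dots,f_k+k$ into increasing order (the sign of the sorting permutation). -}

module Defs where

open import Data.Nat as ℕ using (ℕ; zero; suc)
open import Data.Nat.Properties using (_!≢0)
open import Data.Nat.Combinatorics using (_C_)
open import Data.Integer as ℤ using (ℤ; +_; -[1+_])
open import Data.Rational as ℚ using (ℚ; 0ℚ; 1ℚ; _/_)
open import Relation.Nullary using (yes; no)
open import Data.Sum using (inj₁; inj₂)
open import Data.Fin as Fin using (Fin; zero; suc; toℕ; punchIn)

ℕtoℚ : ℕ → ℚ
ℕtoℚ n = + n / 1

-- 1/Γ(m) for an integer m, with 1/Γ(m) = 0 for m ∈ {0,-1,-2,...}
-- and 1/Γ(n+1) = 1/n! for n ≥ 0.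
recipGamma : ℤ → ℚ
recipGamma (+ zero)    = 0ℚ
recipGamma -[1+ _ ]    = 0ℚ
recipGamma (+ (suc n)) = _/_ (+ 1) (n ℕ.!) {{n !≢0}}

negOnePow : ℕ → ℚ
negOnePow zero    = 1ℚ
negOnePow (suc n) = ℚ.- negOnePow n

pow2 : ℕ → ℚ
pow2 zero    = 1ℚ
pow2 (suc n) = ℕtoℚ 2 ℚ.* pow2 n

halfPow : ℕ → ℚ
halfPow zero    = 1ℚ
halfPow (suc n) = (+ 1 / 2) ℚ.* halfPow n

pow2ℤ : ℤ → ℚ
pow2ℤ (+ n)     = pow2 n
pow2ℤ -[1+ n ]  = halfPow (suc n)

sumFin : ∀ {n} → (Fin n → ℚ) → ℚ
sumFin {zero}  f = 0ℚ
sumFin {suc n} f = f zero ℚ.+ sumFin (λ i → f (suc i))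

prodFin : ∀ {n} → (Fin n → ℚ) → ℚ
prodFin {zero}  f = 1ℚ
prodFin {suc n} f = f zero ℚ.* prodFin (λ i → f (suc i))

det : ∀ {n} → (Fin n → Fin n → ℚ) → ℚ
det {zero}  A = 1ℚ
det {suc n} A =
  sumFin (λ j → negOnePow (toℕ j) ℚ.* (A zero j ℚ.* det (λ r s → A (suc r) (punchIn j s))))

countFin : ∀ {n} → (Fin n → ℕ) → ℕ
countFin {zero}  f = 0
countFin {suc n} f = f zero ℕ.+ countFin (λ i → f (suc i))

gtInd : ℤ → ℤ → ℕ
gtInd x y with y ℤ.<? x
... | yes _ = 1
... | no  _ = 0

inversions : ∀ {k} → (Fin k → ℤ) → ℕ
inversions {k} a = countFin (λ i → countFin (λ j → ind i j))
  where
  ind : Fin k → Fin k → ℕ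
  ind i j with toℕ i ℕ.<? toℕ j
  ... | yes _ = gtInd (a i) (a j)
  ... | no  _ = 0
  
-- sgn of a sequence of distinct integers: sign of its sorting permutation
sgnSeq : ∀ {k} → (Fin k → ℤ) → ℚ
sgnSeq a = negOnePow (inversions a)

-- shifted sequence x_i + i (0-based i), i.e. x_{i} + i - 1 in 1-based indexing
shift : ∀ {k} → (Fin k → ℤ) → Fin k → ℤ
shift x i = x i ℤ.+ + toℕ i

-- the 2k × 2k matrix M (0-based indices i, j; i' = i+1, j' = j+1 in the paper)
-- top rows:    M_{i',j'}   = 1/Γ(2k - i' - j' + 2 - e_{i'}) = 1/Γ(2k - i - j - e_i)
-- bottom rows: M_{k+i',j'} = (-1)^{i'+j'-1}/Γ(2k - i' - j' + 2 - f_{i'})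
matM : (k : ℕ) → (Fin k → ℤ) → (Fin k → ℤ) → Fin (k ℕ.+ k) → Fin (k ℕ.+ k) → ℚ
matM k e f r j with Fin.splitAt k r
... | inj₁ i =
  recipGamma (+ (2 ℕ.* k) ℤ.- + toℕ i ℤ.- + toℕ j ℤ.- e i)
... | inj₂ i =
  negOnePow (toℕ i ℕ.+ toℕ j ℕ.+ 1) ℚ.*
  recipGamma (+ (2 ℕ.* k) ℤ.- + toℕ i ℤ.- + toℕ j ℤ.- f i)

{-# OPTIONS --safe #-}

-- With indices from 0, write α_i = e_i + i, β_i = f_i + i and N = 2k − 1, so that the top rows of M are
-- 1/(N − j − α_i)! and the bottom rows ±1/(N − j − β_i)!, with 1/m! = 0 for m < 0. Multiplying M on the
-- right by the unitriangular matrix (1/(m − t)!)ₘₜ replaces each entry by a binomial convolution: the top rows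
-- become 2^(N − t − α_i)/(N − t − α_i)!, and the alternating sums in the bottom rows collapse to ±[t + β_i = N].
-- Since the c_j and the β_i partition {0, …, 2k − 1}, the columns can be reordered as
-- t = N − c_1, …, N − c_k, N − β_1, …, N − β_k; then the bottom rows vanish off the diagonal of the lower right
-- block, and det M is a sign times the k × k determinant of
-- 2^(c_j − α_i)/(c_j − α_i)! = (2^(−α_i) α_i!) (2^(c_j)/c_j!) C(c_j, α_i).
-- Pulling out the row and column factors and using ∏ c_j! ∏ β_i! = ∏ l! (k + l)! gives the constant, and
-- counting the inversions of the column permutation shows that the sign is sgn(f).

module Submission where

open import Algebra.Bundles using (CommutativeSemigroup)
open import Algebra.Core using (Op₂)
open import Algebra.Structures using (IsCommutativeMonoid)
import Algebra.Properties.CommutativeSemigroup as CommutativeSemigroupProperties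
open import Data.Empty using (⊥-elim)
open import Data.Fin as Fin using (Fin; toℕ; punchIn)
import Data.Fin.Properties as Fin
open import Data.Integer as ℤ using (ℤ; +_; ∣_∣)
import Data.Integer.Properties as ℤ
import Data.Integer.Tactic.RingSolver as ℤ-RingSolver
open import Data.Nat as ℕ using (ℕ; zero; suc; _+_; _*_; _∸_; _^_; _≤_; _<_; z≤n; s≤s; NonZero; _≟_; _<?_; _≤?_; _!)
import Data.Nat.Properties as ℕ
open import Data.Nat.Properties using (_!≢0; _!*_!≢0)
open import Data.Nat.Combinatorics using (_C_; k![n∸k]!∣n!; nCk+nC[k+1]≡[n+1]C[k+1])
open import Data.Nat.Combinatorics.Specification using (nCk≡n!/k![n-k]!; k>n⇒nCk≡0)
open import Data.Nat.DivMod using (m/n*n≡m)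
open import Data.Nat.Tactic.RingSolver using (solve-∀)
open import Data.Product using (Σ-syntax; _,_; _×_)
open import Data.Rational as ℚ using (ℚ; 0ℚ; 1ℚ; _/_)
import Data.Rational.Properties as ℚ
open import Data.Rational.Solver using (module +-*-Solver)
open import Data.Rational.Unnormalised as ℚᵘ using (mkℚᵘ; *≡*)
import Data.Rational.Unnormalised.Properties as ℚᵘ
open import Data.Sum using (_⊎_; inj₁; inj₂)
open import Function using (_∘_; id)
open import Relation.Binary.PropositionalEquality
open import Relation.Binary.Definitions using (tri<; tri≈; tri>)
open import Relation.Nullary using (Dec; yes; no; ¬_)

open import Defs

open +-*-Solver

punchInℕ : ℕ → ℕ → ℕ
punchInℕ zero    s       = suc s
punchInℕ (suc j) zero    = zero
punchInℕ (suc j) (suc s) = suc (punchInℕ j s)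

punchOutℕ : ℕ → ℕ → ℕ
punchOutℕ zero    x       = ℕ.pred x
punchOutℕ (suc v) zero    = zero
punchOutℕ (suc v) (suc x) = suc (punchOutℕ v x)

punchInℕ-≢ : ∀ j s → punchInℕ j s ≢ j
punchInℕ-≢ zero    s       ()
punchInℕ-≢ (suc j) zero    ()
punchInℕ-≢ (suc j) (suc s) eq = punchInℕ-≢ j s (ℕ.suc-injective eq)

punchInℕ-punchOutℕ : ∀ v x → x ≢ v → punchInℕ v (punchOutℕ v x) ≡ x
punchInℕ-punchOutℕ zero    zero    x≢v = ⊥-elim (x≢v refl)
punchInℕ-punchOutℕ zero    (suc x) _   = refl
punchInℕ-punchOutℕ (suc v) zero    _   = refl
punchInℕ-punchOutℕ (suc v) (suc x) x≢v = cong suc (punchInℕ-punchOutℕ v x (x≢v ∘ cong suc))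

punchOutℕ-punchInℕ : ∀ v s → punchOutℕ v (punchInℕ v s) ≡ s
punchOutℕ-punchInℕ zero    s       = refl
punchOutℕ-punchInℕ (suc v) zero    = refl
punchOutℕ-punchInℕ (suc v) (suc s) = cong suc (punchOutℕ-punchInℕ v s)

punchInℕ-injective : ∀ j s t → punchInℕ j s ≡ punchInℕ j t → s ≡ t
punchInℕ-injective j s t eq =
  trans (sym (punchOutℕ-punchInℕ j s)) (trans (cong (punchOutℕ j) eq) (punchOutℕ-punchInℕ j t))

punchInℕ-< : ∀ {n} j s → s < n → punchInℕ j s < suc n
punchInℕ-< zero s s<n = s≤s s<n
punchInℕ-< (suc j) zero _ = s≤s z≤n
punchInℕ-< {suc n} (suc j) (suc s) (s≤s s<n) = s≤s (punchInℕ-< j s s<n)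

punchOutℕ-< : ∀ {n} v x → v ≤ n → x < suc n → x ≢ v → punchOutℕ v x < n
punchOutℕ-< zero zero _ _ x≢v = ⊥-elim (x≢v refl)
punchOutℕ-< zero (suc x) _ (s≤s x<n) _ = x<n
punchOutℕ-< {suc n} (suc v) zero _ _ _ = s≤s z≤n
punchOutℕ-< {suc n} (suc v) (suc x) (s≤s v≤n) (s≤s x<n) x≢v =
  s≤s (punchOutℕ-< v x v≤n x<n (x≢v ∘ cong suc))

punchInℕ-≥ : ∀ j s → j ≤ s → punchInℕ j s ≡ suc s
punchInℕ-≥ zero    s       _         = refl
punchInℕ-≥ (suc j) (suc s) (s≤s j≤s) = cong suc (punchInℕ-≥ j s j≤s)

punchInℕ-mono-< : ∀ j s t → s < t → punchInℕ j s < punchInℕ j t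
punchInℕ-mono-< zero    s       t       s<t       = s≤s s<t
punchInℕ-mono-< (suc j) zero    (suc t) _         = s≤s z≤n
punchInℕ-mono-< (suc j) (suc s) (suc t) (s≤s s<t) = s≤s (punchInℕ-mono-< j s t s<t)

punchInℕ-cancel-< : ∀ j s t → punchInℕ j s < punchInℕ j t → s < t
punchInℕ-cancel-< j s t lt with ℕ.<-cmp s t
... | tri< s<t _ _ = s<t
... | tri≈ _ refl _ = ⊥-elim (ℕ.<-irrefl refl lt)
... | tri> _ _ t<s = ⊥-elim (ℕ.<-asym lt (punchInℕ-mono-< j t s t<s))

module RangeFold {A : Set} {_∙_ : Op₂ A} {ε : A} (isCM : IsCommutativeMonoid _≡_ _∙_ ε) where

  open IsCommutativeMonoid isCM using (assoc; identityˡ; identityʳ; isCommutativeSemigroup)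

  private
    commutativeSemigroup : CommutativeSemigroup _ _
    commutativeSemigroup = record { isCommutativeSemigroup = isCommutativeSemigroup }

  open CommutativeSemigroupProperties commutativeSemigroup using (interchange; x∙yz≈y∙xz)

  fold : ℕ → (ℕ → A) → A
  fold zero    f = ε
  fold (suc n) f = f 0 ∙ fold n (f ∘ suc)

  fold-cong : ∀ n {f g} → (∀ i → i < n → f i ≡ g i) → fold n f ≡ fold n g
  fold-cong zero    f≡g = refl
  fold-cong (suc n) f≡g = cong₂ _∙_ (f≡g 0 (s≤s z≤n)) (fold-cong n (λ i i<n → f≡g (suc i) (s≤s i<n)))

  fold-ε : ∀ n {f} → (∀ i → i < n → f i ≡ ε) → fold n f ≡ ε
  fold-ε zero    f≡ε = refl
  fold-ε (suc n) f≡ε =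
    trans (cong₂ _∙_ (f≡ε 0 (s≤s z≤n)) (fold-ε n (λ i i<n → f≡ε (suc i) (s≤s i<n)))) (identityˡ ε)

  fold-distrib : ∀ n f g → fold n (λ i → f i ∙ g i) ≡ fold n f ∙ fold n g
  fold-distrib zero    f g = sym (identityˡ ε)
  fold-distrib (suc n) f g =
    trans (cong ((f 0 ∙ g 0) ∙_) (fold-distrib n (f ∘ suc) (g ∘ suc))) (interchange (f 0) (g 0) _ _)

  fold-+ : ∀ m n f → fold (m + n) f ≡ fold m f ∙ fold n (λ i → f (m + i))
  fold-+ zero    n f = sym (identityˡ _)
  fold-+ (suc m) n f = trans (cong (f 0 ∙_) (fold-+ m n (f ∘ suc))) (sym (assoc _ _ _))

  fold-init-last : ∀ n f → fold (suc n) f ≡ fold n f ∙ f n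
  fold-init-last n f = begin
    fold (suc n) f              ≡⟨ cong (λ m → fold m f) (ℕ.+-comm 1 n) ⟩
    fold (n + 1) f              ≡⟨ fold-+ n 1 f ⟩
    fold n f ∙ (f (n + 0) ∙ ε)  ≡⟨ cong (fold n f ∙_) (trans (identityʳ _) (cong f (ℕ.+-identityʳ n))) ⟩
    fold n f ∙ f n              ∎
    where open ≡-Reasoning

  fold-remove : ∀ n j f → j ≤ n → fold (suc n) f ≡ f j ∙ fold n (f ∘ punchInℕ j)
  fold-remove n       zero    f _         = refl
  fold-remove (suc n) (suc j) f (s≤s j≤n) =
    trans (cong (f 0 ∙_) (fold-remove n j (f ∘ suc) j≤n)) (x∙yz≈y∙xz _ _ _)

  fold-permute : ∀ n (π : ℕ → ℕ) f → (∀ i → i < n → π i < n) →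
                 (∀ i j → i < n → j < n → π i ≡ π j → i ≡ j) →
                 fold n (f ∘ π) ≡ fold n f
  fold-permute zero    π f _  _   = refl
  fold-permute (suc n) π f bd inj = begin
      f v ∙ fold n (f ∘ π ∘ suc)
    ≡⟨ cong (f v ∙_) (fold-cong n (λ i i<n → cong f (sym (punchInℕ-punchOutℕ v _ (π-suc≢v i i<n))))) ⟩
      f v ∙ fold n (f ∘ punchInℕ v ∘ π′)
    ≡⟨ cong (f v ∙_) (fold-permute n π′ (f ∘ punchInℕ v) π′-bd π′-inj) ⟩
      f v ∙ fold n (f ∘ punchInℕ v)
    ≡⟨ fold-remove n v f v≤n ⟨
      fold (suc n) f
    ∎
    where
    open ≡-Reasoning
    v = π 0
    v≤n : v ≤ n
    v≤n = ℕ.≤-pred (bd 0 (s≤s z≤n))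
    π-suc≢v : ∀ i → i < n → π (suc i) ≢ v
    π-suc≢v i i<n eq with inj (suc i) 0 (s≤s i<n) (s≤s z≤n) eq
    ... | ()
    π′ : ℕ → ℕ
    π′ i = punchOutℕ v (π (suc i))
    π′-bd : ∀ i → i < n → π′ i < n
    π′-bd i i<n = punchOutℕ-< v (π (suc i)) v≤n (bd (suc i) (s≤s i<n)) (π-suc≢v i i<n)
    π′-inj : ∀ i j → i < n → j < n → π′ i ≡ π′ j → i ≡ j
    π′-inj i j i<n j<n eq = ℕ.suc-injective (inj (suc i) (suc j) (s≤s i<n) (s≤s j<n) (begin
      π (suc i)               ≡⟨ punchInℕ-punchOutℕ v _ (π-suc≢v i i<n) ⟨
      punchInℕ v (π′ i)       ≡⟨ cong (punchInℕ v) eq ⟩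
      punchInℕ v (π′ j)       ≡⟨ punchInℕ-punchOutℕ v _ (π-suc≢v j j<n) ⟩
      π (suc j)               ∎))

  fold-single : ∀ n j f → j < n → (∀ i → i < n → i ≢ j → f i ≡ ε) → fold n f ≡ f j
  fold-single (suc n) j f (s≤s j≤n) others-ε = begin
    fold (suc n) f                ≡⟨ fold-remove n j f j≤n ⟩
    f j ∙ fold n (f ∘ punchInℕ j) ≡⟨ cong (f j ∙_) (fold-ε n (λ i i<n → others-ε _ (punchInℕ-< j i i<n) (punchInℕ-≢ j i))) ⟩
    f j ∙ ε                       ≡⟨ identityʳ (f j) ⟩
    f j                           ∎
    where open ≡-Reasoning

  fold-comm : ∀ m n (f : ℕ → ℕ → A) → fold m (λ i → fold n (f i)) ≡ fold n (λ j → fold m (λ i → f i j))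
  fold-comm zero    n f = sym (fold-ε n (λ _ _ → refl))
  fold-comm (suc m) n f =
    trans (cong (fold n (f 0) ∙_) (fold-comm m n (f ∘ suc))) (sym (fold-distrib n (f 0) _))

module Sumℚ = RangeFold ℚ.+-0-isCommutativeMonoid
module Prodℚ = RangeFold ℚ.*-1-isCommutativeMonoid
module Sumℕ = RangeFold ℕ.+-0-isCommutativeMonoid

∑ℚ : ℕ → (ℕ → ℚ) → ℚ
∑ℚ = Sumℚ.fold

∏ℚ : ℕ → (ℕ → ℚ) → ℚ
∏ℚ = Prodℚ.fold

∑ℕ : ℕ → (ℕ → ℕ) → ℕ
∑ℕ = Sumℕ.fold

*-distribˡ-∑ℚ : ∀ n a f → ∑ℚ n (λ i → a ℚ.* f i) ≡ a ℚ.* ∑ℚ n f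
*-distribˡ-∑ℚ zero    a f = sym (ℚ.*-zeroʳ a)
*-distribˡ-∑ℚ (suc n) a f =
  trans (cong (a ℚ.* f 0 ℚ.+_) (*-distribˡ-∑ℚ n a (f ∘ suc))) (sym (ℚ.*-distribˡ-+ a (f 0) _))

*-distribʳ-∑ℚ : ∀ n a f → ∑ℚ n (λ i → f i ℚ.* a) ≡ ∑ℚ n f ℚ.* a
*-distribʳ-∑ℚ n a f =
  trans (Sumℚ.fold-cong n (λ i _ → ℚ.*-comm (f i) a)) (trans (*-distribˡ-∑ℚ n a f) (ℚ.*-comm a _))

neg-distrib-∑ℚ : ∀ n f → ∑ℚ n (λ i → ℚ.- f i) ≡ ℚ.- ∑ℚ n f
neg-distrib-∑ℚ zero    f = refl
neg-distrib-∑ℚ (suc n) f =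
  trans (cong (ℚ.- f 0 ℚ.+_) (neg-distrib-∑ℚ n (f ∘ suc))) (sym (ℚ.neg-distrib-+ (f 0) _))

-- Determinants

-- Matrices are indexed by ℕ, so that minors and column permutations act by index arithmetic;
-- det′ n A only reads the top-left n × n block of A.
Mat : Set
Mat = ℕ → ℕ → ℚ

minor : ℕ → Mat → Mat
minor j A r s = A (suc r) (punchInℕ j s)

laplaceTerm : ℕ → Mat → ℕ → ℚ
det′ : ℕ → Mat → ℚ

laplaceTerm n A j = negOnePow j ℚ.* (A 0 j ℚ.* det′ n (minor j A))

det′ zero    A = 1ℚ
det′ (suc n) A = ∑ℚ (suc n) (laplaceTerm n A)

det′-cong : ∀ n {A B : Mat} → (∀ r s → r < n → s < n → A r s ≡ B r s) → det′ n A ≡ det′ n B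
det′-cong zero    A≡B = refl
det′-cong (suc n) A≡B = Sumℚ.fold-cong (suc n) λ j j<n →
  cong (λ x → negOnePow j ℚ.* x) (cong₂ ℚ._*_ (A≡B 0 j (s≤s z≤n) j<n)
    (det′-cong n (λ r s r<n s<n → A≡B (suc r) (punchInℕ j s) (s≤s r<n) (punchInℕ-< j s s<n))))

sumFin-cong : ∀ n {f g : Fin n → ℚ} → (∀ i → f i ≡ g i) → sumFin f ≡ sumFin g
sumFin-cong zero    f≡g = refl
sumFin-cong (suc n) f≡g = cong₂ ℚ._+_ (f≡g Fin.zero) (sumFin-cong n (f≡g ∘ Fin.suc))

prodFin-cong : ∀ n {f g : Fin n → ℚ} → (∀ i → f i ≡ g i) → prodFin f ≡ prodFin g
prodFin-cong zero    f≡g = refl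
prodFin-cong (suc n) f≡g = cong₂ ℚ._*_ (f≡g Fin.zero) (prodFin-cong n (f≡g ∘ Fin.suc))

countFin-cong : ∀ n {f g : Fin n → ℕ} → (∀ i → f i ≡ g i) → countFin f ≡ countFin g
countFin-cong zero    f≡g = refl
countFin-cong (suc n) f≡g = cong₂ _+_ (f≡g Fin.zero) (countFin-cong n (f≡g ∘ Fin.suc))

det-cong : ∀ n {A B : Fin n → Fin n → ℚ} → (∀ r s → A r s ≡ B r s) → det A ≡ det B
det-cong zero    A≡B = refl
det-cong (suc n) A≡B = sumFin-cong (suc n) λ j →
  cong (λ x → negOnePow (toℕ j) ℚ.* x)
    (cong₂ ℚ._*_ (A≡B Fin.zero j) (det-cong n (λ r s → A≡B (Fin.suc r) (punchIn j s))))

sumFin-toℕ : ∀ n (g : ℕ → ℚ) → sumFin {n} (g ∘ toℕ) ≡ ∑ℚ n g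
sumFin-toℕ zero    g = refl
sumFin-toℕ (suc n) g = cong (g 0 ℚ.+_) (sumFin-toℕ n (g ∘ suc))

prodFin-toℕ : ∀ n (g : ℕ → ℚ) → prodFin {n} (g ∘ toℕ) ≡ ∏ℚ n g
prodFin-toℕ zero    g = refl
prodFin-toℕ (suc n) g = cong (g 0 ℚ.*_) (prodFin-toℕ n (g ∘ suc))

countFin-toℕ : ∀ n (g : ℕ → ℕ) → countFin {n} (g ∘ toℕ) ≡ ∑ℕ n g
countFin-toℕ zero    g = refl
countFin-toℕ (suc n) g = cong (g 0 ℕ.+_) (countFin-toℕ n (g ∘ suc))

toℕ-punchIn : ∀ {n} (j : Fin (suc n)) (s : Fin n) → toℕ (punchIn j s) ≡ punchInℕ (toℕ j) (toℕ s)
toℕ-punchIn Fin.zero    s            = refl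
toℕ-punchIn (Fin.suc j) Fin.zero     = refl
toℕ-punchIn (Fin.suc j) (Fin.suc s)  = cong suc (toℕ-punchIn j s)

det-toℕ : ∀ n (A : Mat) → det {n} (λ r s → A (toℕ r) (toℕ s)) ≡ det′ n A
det-toℕ zero    A = refl
det-toℕ (suc n) A = trans
  (sumFin-cong (suc n) (λ j → cong (λ x → negOnePow (toℕ j) ℚ.* (A 0 (toℕ j) ℚ.* x)) (minor-toℕ j)))
  (sumFin-toℕ (suc n) (laplaceTerm n A))
  where
  minor-toℕ : ∀ j → det {n} (λ r s → A (suc (toℕ r)) (toℕ (punchIn j s))) ≡ det′ n (minor (toℕ j) A)
  minor-toℕ j =
    trans (det-cong n (λ r s → cong (A (suc (toℕ r))) (toℕ-punchIn j s))) (det-toℕ n (minor (toℕ j) A))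

∑ℚ-linear : ∀ n a b f g → ∑ℚ n (λ i → a ℚ.* f i ℚ.+ b ℚ.* g i) ≡ a ℚ.* ∑ℚ n f ℚ.+ b ℚ.* ∑ℚ n g
∑ℚ-linear n a b f g =
  trans (Sumℚ.fold-distrib n _ _) (cong₂ ℚ._+_ (*-distribˡ-∑ℚ n a f) (*-distribˡ-∑ℚ n b g))

det′-linear-col : ∀ n q → q < n → (A B D : Mat) (a b : ℚ) →
  (∀ r s → s ≢ q → B r s ≡ A r s) → (∀ r s → s ≢ q → D r s ≡ A r s) →
  (∀ r → D r q ≡ a ℚ.* A r q ℚ.+ b ℚ.* B r q) →
  det′ n D ≡ a ℚ.* det′ n A ℚ.+ b ℚ.* det′ n B
det′-linear-col (suc n) q q<n A B D a b B≡A D≡A Dq =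
  trans (Sumℚ.fold-cong (suc n) term) (∑ℚ-linear (suc n) a b (laplaceTerm n A) (laplaceTerm n B))
  where
  term : ∀ j → j < suc n → laplaceTerm n D j ≡ a ℚ.* laplaceTerm n A j ℚ.+ b ℚ.* laplaceTerm n B j
  term j j<n with j ≟ q
  ... | yes refl = begin
      negOnePow j ℚ.* (D 0 j ℚ.* det′ n (minor j D))
    ≡⟨ cong₂ (λ x y → negOnePow j ℚ.* (x ℚ.* y)) (Dq 0) (trans (det′-cong n minorD≡minorA) (det′-cong n minorA≡minorB)) ⟩
      negOnePow j ℚ.* ((a ℚ.* A 0 j ℚ.+ b ℚ.* B 0 j) ℚ.* det′ n (minor j B))
    ≡⟨ solve 6 (λ σ a b x y d → σ :* ((a :* x :+ b :* y) :* d) := a :* (σ :* (x :* d)) :+ b :* (σ :* (y :* d))) refl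
         (negOnePow j) a b (A 0 j) (B 0 j) (det′ n (minor j B)) ⟩
      a ℚ.* (negOnePow j ℚ.* (A 0 j ℚ.* det′ n (minor j B))) ℚ.+ b ℚ.* laplaceTerm n B j
    ≡⟨ cong (λ x → a ℚ.* (negOnePow j ℚ.* (A 0 j ℚ.* x)) ℚ.+ b ℚ.* laplaceTerm n B j) (det′-cong n minorA≡minorB) ⟨
      a ℚ.* laplaceTerm n A j ℚ.+ b ℚ.* laplaceTerm n B j
    ∎
    where
    open ≡-Reasoning
    minorD≡minorA : ∀ r s → r < n → s < n → minor j D r s ≡ minor j A r s
    minorD≡minorA r s _ _ = D≡A (suc r) (punchInℕ j s) (punchInℕ-≢ j s)
    minorA≡minorB : ∀ r s → r < n → s < n → minor j A r s ≡ minor j B r s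
    minorA≡minorB r s _ _ = sym (B≡A (suc r) (punchInℕ j s) (punchInℕ-≢ j s))
  ... | no j≢q = begin
      negOnePow j ℚ.* (D 0 j ℚ.* det′ n (minor j D))
    ≡⟨ cong₂ (λ x y → negOnePow j ℚ.* (x ℚ.* y)) (D≡A 0 j j≢q) minor-linear ⟩
      negOnePow j ℚ.* (A 0 j ℚ.* (a ℚ.* det′ n (minor j A) ℚ.+ b ℚ.* det′ n (minor j B)))
    ≡⟨ solve 6 (λ σ a b x y d → σ :* (x :* (a :* y :+ b :* d)) := a :* (σ :* (x :* y)) :+ b :* (σ :* (x :* d))) refl
         (negOnePow j) a b (A 0 j) (det′ n (minor j A)) (det′ n (minor j B)) ⟩
      a ℚ.* laplaceTerm n A j ℚ.+ b ℚ.* (negOnePow j ℚ.* (A 0 j ℚ.* det′ n (minor j B)))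
    ≡⟨ cong (λ x → a ℚ.* laplaceTerm n A j ℚ.+ b ℚ.* (negOnePow j ℚ.* (x ℚ.* det′ n (minor j B)))) (B≡A 0 j j≢q) ⟨
      a ℚ.* laplaceTerm n A j ℚ.+ b ℚ.* laplaceTerm n B j
    ∎
    where
    open ≡-Reasoning
    q≢j : q ≢ j
    q≢j = j≢q ∘ sym
    q′ = punchOutℕ j q
    punchIn-q′ : punchInℕ j q′ ≡ q
    punchIn-q′ = punchInℕ-punchOutℕ j q q≢j
    off-q′ : ∀ s → s ≢ q′ → punchInℕ j s ≢ q
    off-q′ s s≢q′ eq = s≢q′ (trans (sym (punchOutℕ-punchInℕ j s)) (cong (punchOutℕ j) eq))
    minor-linear : det′ n (minor j D) ≡ a ℚ.* det′ n (minor j A) ℚ.+ b ℚ.* det′ n (minor j B)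
    minor-linear = det′-linear-col n q′ (punchOutℕ-< j q (ℕ.≤-pred j<n) q<n q≢j) (minor j A) (minor j B) (minor j D) a b
      (λ r s s≢q′ → B≡A (suc r) (punchInℕ j s) (off-q′ s s≢q′))
      (λ r s s≢q′ → D≡A (suc r) (punchInℕ j s) (off-q′ s s≢q′))
      (λ r → subst (λ x → D (suc r) x ≡ a ℚ.* A (suc r) x ℚ.+ b ℚ.* B (suc r) x) (sym punchIn-q′) (Dq (suc r)))

adjSwap : ℕ → ℕ → ℕ
adjSwap zero    zero          = 1
adjSwap zero    (suc zero)    = 0
adjSwap zero    (suc (suc x)) = suc (suc x)
adjSwap (suc p) zero          = zero
adjSwap (suc p) (suc x)       = suc (adjSwap p x)

adjSwap-involutive : ∀ p x → adjSwap p (adjSwap p x) ≡ x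
adjSwap-involutive zero    zero          = refl
adjSwap-involutive zero    (suc zero)    = refl
adjSwap-involutive zero    (suc (suc x)) = refl
adjSwap-involutive (suc p) zero          = refl
adjSwap-involutive (suc p) (suc x)       = cong suc (adjSwap-involutive p x)

adjSwap-< : ∀ {m} p x → suc p < m → x < m → adjSwap p x < m
adjSwap-< zero    zero          (s≤s (s≤s _)) _   = s≤s (s≤s z≤n)
adjSwap-< zero    (suc zero)    _             x<m = ℕ.≤-trans (s≤s z≤n) x<m
adjSwap-< zero    (suc (suc x)) _             x<m = x<m
adjSwap-< (suc p) zero          _             x<m = x<m
adjSwap-< {suc m} (suc p) (suc x) (s≤s sp<m) (s≤s x<m) = s≤s (adjSwap-< p x sp<m x<m)

adjSwap-below : ∀ p x → x < p → adjSwap p x ≡ x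
adjSwap-below (suc p) zero    _         = refl
adjSwap-below (suc p) (suc x) (s≤s x<p) = cong suc (adjSwap-below p x x<p)

adjSwap-above : ∀ p x → suc (suc p) ≤ x → adjSwap p x ≡ x
adjSwap-above zero    (suc (suc x)) _           = refl
adjSwap-above zero    (suc zero)    (s≤s ())
adjSwap-above (suc p) (suc x)       (s≤s sp<x)  = cong suc (adjSwap-above p x sp<x)

adjSwap-self : ∀ p → adjSwap p p ≡ suc p
adjSwap-self zero    = refl
adjSwap-self (suc p) = cong suc (adjSwap-self p)

adjSwap-suc : ∀ p → adjSwap p (suc p) ≡ p
adjSwap-suc zero    = refl
adjSwap-suc (suc p) = cong suc (adjSwap-suc p)

adjSwap-punchIn-self : ∀ p s → adjSwap p (punchInℕ p s) ≡ punchInℕ (suc p) s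
adjSwap-punchIn-self zero    zero    = refl
adjSwap-punchIn-self zero    (suc s) = refl
adjSwap-punchIn-self (suc p) zero    = refl
adjSwap-punchIn-self (suc p) (suc s) = cong suc (adjSwap-punchIn-self p s)

adjSwap-punchIn-suc : ∀ p s → adjSwap p (punchInℕ (suc p) s) ≡ punchInℕ p s
adjSwap-punchIn-suc p s =
  trans (cong (adjSwap p) (sym (adjSwap-punchIn-self p s))) (adjSwap-involutive p (punchInℕ p s))

adjSwap-punchIn-below : ∀ p j s → j < p → adjSwap p (punchInℕ j s) ≡ punchInℕ j (adjSwap (ℕ.pred p) s)
adjSwap-punchIn-below (suc p)       zero    s       _               = refl
adjSwap-punchIn-below (suc zero)    (suc j) s       (s≤s ())
adjSwap-punchIn-below (suc (suc p)) (suc j) zero    _               = refl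
adjSwap-punchIn-below (suc (suc p)) (suc j) (suc s) (s≤s (s≤s j<p)) = cong suc (adjSwap-punchIn-below (suc p) j s (s≤s j<p))

adjSwap-punchIn-above : ∀ p j s → suc (suc p) ≤ j → adjSwap p (punchInℕ j s) ≡ punchInℕ j (adjSwap p s)
adjSwap-punchIn-above zero    (suc (suc j)) zero          _ = refl
adjSwap-punchIn-above zero    (suc (suc j)) (suc zero)    _ = refl
adjSwap-punchIn-above zero    (suc (suc j)) (suc (suc s)) _ = refl
adjSwap-punchIn-above zero    (suc zero)    _             (s≤s ())
adjSwap-punchIn-above (suc p) (suc j)       zero          _ = refl
adjSwap-punchIn-above (suc p) (suc j)       (suc s)       (s≤s ssp≤j) = cong suc (adjSwap-punchIn-above p j s ssp≤j)

det′-swap-adjacent : ∀ n p → suc p < n → (A : Mat) → det′ n (λ r s → A r (adjSwap p s)) ≡ ℚ.- det′ n A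
det′-swap-adjacent (suc n) p sp<n A = begin
    ∑ℚ (suc n) (laplaceTerm n Aτ)
  ≡⟨ Sumℚ.fold-cong (suc n) term ⟩
    ∑ℚ (suc n) (λ j → ℚ.- laplaceTerm n A (adjSwap p j))
  ≡⟨ neg-distrib-∑ℚ (suc n) (laplaceTerm n A ∘ adjSwap p) ⟩
    ℚ.- ∑ℚ (suc n) (laplaceTerm n A ∘ adjSwap p)
  ≡⟨ cong ℚ.-_ (Sumℚ.fold-permute (suc n) (adjSwap p) (laplaceTerm n A) (λ i → adjSwap-< p i sp<n) adjSwap-inj) ⟩
    ℚ.- ∑ℚ (suc n) (laplaceTerm n A)
  ∎
  where
  open ≡-Reasoning
  Aτ : Mat
  Aτ r s = A r (adjSwap p s)
  adjSwap-inj : ∀ i j → i < suc n → j < suc n → adjSwap p i ≡ adjSwap p j → i ≡ j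
  adjSwap-inj i j _ _ eq = trans (sym (adjSwap-involutive p i)) (trans (cong (adjSwap p) eq) (adjSwap-involutive p j))
  fixed : ∀ j → adjSwap p j ≡ j → det′ n (minor j Aτ) ≡ ℚ.- det′ n (minor j A) →
          laplaceTerm n Aτ j ≡ ℚ.- laplaceTerm n A (adjSwap p j)
  fixed j τj≡j minor-swapped rewrite τj≡j =
    trans (cong (λ x → negOnePow j ℚ.* (A 0 j ℚ.* x)) minor-swapped)
      (solve 3 (λ σ x y → σ :* (x :* (:- y)) := :- (σ :* (x :* y))) refl (negOnePow j) (A 0 j) (det′ n (minor j A)))
  below : ∀ j → j < p → det′ n (minor j Aτ) ≡ ℚ.- det′ n (minor j A)
  below j j<p =
    trans (det′-cong n (λ r s _ _ → cong (A (suc r)) (adjSwap-punchIn-below p j s j<p)))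
      (det′-swap-adjacent n (ℕ.pred p) (subst (_< n) (sym suc-pred-p) (ℕ.≤-pred sp<n)) (minor j A))
    where
    suc-pred-p : suc (ℕ.pred p) ≡ p
    suc-pred-p = ℕ.suc-pred p {{ℕ.>-nonZero (ℕ.≤-trans (s≤s z≤n) j<p)}}
  term : ∀ j → j < suc n → laplaceTerm n Aτ j ≡ ℚ.- laplaceTerm n A (adjSwap p j)
  term j j<n with ℕ.<-cmp j p
  ... | tri< j<p _ _ = fixed j (adjSwap-below p j j<p) (below j j<p)
  ... | tri≈ _ refl _ rewrite adjSwap-self j =
    trans (cong (λ x → negOnePow j ℚ.* (A 0 (suc j) ℚ.* x)) (det′-cong n (λ r s _ _ → cong (A (suc r)) (adjSwap-punchIn-self j s))))
      (solve 3 (λ σ x y → σ :* (x :* y) := :- ((:- σ) :* (x :* y))) refl (negOnePow j) (A 0 (suc j)) (det′ n (minor (suc j) A)))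
  ... | tri> _ _ p<j with j ≟ suc p
  ...   | yes refl rewrite adjSwap-suc p =
    trans (cong (λ x → ℚ.- negOnePow p ℚ.* (A 0 p ℚ.* x)) (det′-cong n (λ r s _ _ → cong (A (suc r)) (adjSwap-punchIn-suc p s))))
      (solve 3 (λ σ x y → (:- σ) :* (x :* y) := :- (σ :* (x :* y))) refl (negOnePow p) (A 0 p) (det′ n (minor p A)))
  ...   | no j≢sp = fixed j (adjSwap-above p j ssp≤j)
    (trans (det′-cong n (λ r s _ _ → cong (A (suc r)) (adjSwap-punchIn-above p j s ssp≤j)))
      (det′-swap-adjacent n p (ℕ.≤-pred (ℕ.≤-trans (s≤s ssp≤j) j<n)) (minor j A)))
    where
    ssp≤j : suc (suc p) ≤ j
    ssp≤j = ℕ.≤∧≢⇒< p<j (j≢sp ∘ sym)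

x≡-x⇒x≡0 : ∀ x → x ≡ ℚ.- x → x ≡ 0ℚ
x≡-x⇒x≡0 x x≡-x = begin
  x                        ≡⟨ solve 1 (λ x → x := con (+ 1 / 2) :* (x :+ x)) refl x ⟩
  (+ 1 / 2) ℚ.* (x ℚ.+ x)  ≡⟨ cong (λ y → (+ 1 / 2) ℚ.* (x ℚ.+ y)) x≡-x ⟩
  (+ 1 / 2) ℚ.* (x ℚ.- x)  ≡⟨ cong ((+ 1 / 2) ℚ.*_) (ℚ.+-inverseʳ x) ⟩
  (+ 1 / 2) ℚ.* 0ℚ         ≡⟨ ℚ.*-zeroʳ (+ 1 / 2) ⟩
  0ℚ                       ∎
  where open ≡-Reasoning

det′-equal-cols-at-distance : ∀ d n (A : Mat) p → suc (p + d) < n →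
  (∀ r → A r p ≡ A r (suc (p + d))) → det′ n A ≡ 0ℚ
det′-equal-cols-at-distance zero n A p sp<n Ap≡Asp =
  x≡-x⇒x≡0 _ (trans (sym (det′-cong n (λ r s _ _ → swap-fixes r s))) (det′-swap-adjacent n p sp<n′ A))
  where
  sp<n′ : suc p < n
  sp<n′ = subst (λ x → suc x < n) (ℕ.+-identityʳ p) sp<n
  swap-fixes : ∀ r s → A r (adjSwap p s) ≡ A r s
  swap-fixes r s with ℕ.<-cmp s p
  ... | tri< s<p _ _  = cong (A r) (adjSwap-below p s s<p)
  ... | tri≈ _ refl _ = trans (cong (A r) (adjSwap-self s)) (sym (trans (Ap≡Asp r) (cong (A r ∘ suc) (ℕ.+-identityʳ s))))
  ... | tri> _ _ p<s with s ≟ suc p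
  ...   | yes refl = trans (cong (A r) (adjSwap-suc p)) (trans (Ap≡Asp r) (cong (A r ∘ suc) (ℕ.+-identityʳ p)))
  ...   | no s≢sp  = cong (A r) (adjSwap-above p s (ℕ.≤∧≢⇒< p<s (s≢sp ∘ sym)))
det′-equal-cols-at-distance (suc d) n A p sp+sd<n Ap≡Asp+sd =
  ℚ.neg-injective (trans (sym (det′-swap-adjacent n m sm<n A))
    (det′-equal-cols-at-distance d n (λ r s → A r (adjSwap m s)) p (ℕ.<-trans (ℕ.n<1+n m) sm<n) swapped-equal))
  where
  m = suc (p + d)
  sp+sd≡sm : suc (p + suc d) ≡ suc m
  sp+sd≡sm = cong suc (ℕ.+-suc p d)
  sm<n : suc m < n
  sm<n = subst (_< n) sp+sd≡sm sp+sd<n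
  swapped-equal : ∀ r → A r (adjSwap m p) ≡ A r (adjSwap m m)
  swapped-equal r = begin
    A r (adjSwap m p)      ≡⟨ cong (A r) (adjSwap-below m p (s≤s (ℕ.m≤m+n p d))) ⟩
    A r p                  ≡⟨ Ap≡Asp+sd r ⟩
    A r (suc (p + suc d))  ≡⟨ cong (A r) sp+sd≡sm ⟩
    A r (suc m)            ≡⟨ cong (A r) (adjSwap-self m) ⟨
    A r (adjSwap m m)      ∎
    where open ≡-Reasoning

det′-equal-cols : ∀ n (A : Mat) p q → p < q → q < n → (∀ r → A r p ≡ A r q) → det′ n A ≡ 0ℚ
det′-equal-cols n A p q p<q q<n Ap≡Aq =
  det′-equal-cols-at-distance (q ∸ suc p) n A p (subst (_< n) (sym q≡) q<n) (λ r → trans (Ap≡Aq r) (cong (A r) (sym q≡)))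
  where
  q≡ : suc (p + (q ∸ suc p)) ≡ q
  q≡ = ℕ.m+[n∸m]≡n p<q

setCol : ℕ → (ℕ → ℚ) → Mat → Mat
setCol q v A r s with s ≟ q
... | yes _ = v r
... | no  _ = A r s

setCol-≡ : ∀ q v A r → setCol q v A r q ≡ v r
setCol-≡ q v A r with q ≟ q
... | yes _   = refl
... | no q≢q  = ⊥-elim (q≢q refl)

setCol-≢ : ∀ q v A r s → s ≢ q → setCol q v A r s ≡ A r s
setCol-≢ q v A r s s≢q with s ≟ q
... | yes s≡q = ⊥-elim (s≢q s≡q)
... | no  _   = refl

det′-∑-col : ∀ L n q → q < n → (A : Mat) (w : ℕ → ℚ) (V : ℕ → ℕ → ℚ) →
  det′ n (setCol q (λ r → ∑ℚ L (λ m → w m ℚ.* V m r)) A) ≡ ∑ℚ L (λ m → w m ℚ.* det′ n (setCol q (V m) A))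
det′-∑-col zero n q q<n A w V = begin
    det′ n (setCol q (λ _ → 0ℚ) A)
  ≡⟨ det′-linear-col n q q<n A A (setCol q (λ _ → 0ℚ) A) 0ℚ 0ℚ (λ _ _ _ → refl) (setCol-≢ q _ A)
       (λ r → trans (setCol-≡ q _ A r) (solve 1 (λ x → con 0ℚ := con 0ℚ :* x :+ con 0ℚ :* x) refl (A r q))) ⟩
    0ℚ ℚ.* det′ n A ℚ.+ 0ℚ ℚ.* det′ n A
  ≡⟨ solve 1 (λ x → con 0ℚ :* x :+ con 0ℚ :* x := con 0ℚ) refl (det′ n A) ⟩
    0ℚ
  ∎
  where open ≡-Reasoning
det′-∑-col (suc L) n q q<n A w V = begin
    det′ n (setCol q (λ r → w 0 ℚ.* V 0 r ℚ.+ rest r) A)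
  ≡⟨ det′-linear-col n q q<n (setCol q (V 0) A) (setCol q rest A) _ (w 0) 1ℚ
       (λ r s s≢q → trans (setCol-≢ q _ A r s s≢q) (sym (setCol-≢ q _ A r s s≢q)))
       (λ r s s≢q → trans (setCol-≢ q _ A r s s≢q) (sym (setCol-≢ q _ A r s s≢q)))
       column-q ⟩
    w 0 ℚ.* det′ n (setCol q (V 0) A) ℚ.+ 1ℚ ℚ.* det′ n (setCol q rest A)
  ≡⟨ cong (w 0 ℚ.* det′ n (setCol q (V 0) A) ℚ.+_)
       (trans (ℚ.*-identityˡ _) (det′-∑-col L n q q<n A (w ∘ suc) (V ∘ suc))) ⟩
    ∑ℚ (suc L) (λ m → w m ℚ.* det′ n (setCol q (V m) A))
  ∎
  where
  open ≡-Reasoning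
  rest : ℕ → ℚ
  rest r = ∑ℚ L (λ m → w (suc m) ℚ.* V (suc m) r)
  column-q : ∀ r → setCol q (λ r → w 0 ℚ.* V 0 r ℚ.+ rest r) A r q
                 ≡ w 0 ℚ.* setCol q (V 0) A r q ℚ.+ 1ℚ ℚ.* setCol q rest A r q
  column-q r = begin
    setCol q (λ r → w 0 ℚ.* V 0 r ℚ.+ rest r) A r q       ≡⟨ setCol-≡ q _ A r ⟩
    w 0 ℚ.* V 0 r ℚ.+ rest r                              ≡⟨ cong (w 0 ℚ.* V 0 r ℚ.+_) (ℚ.*-identityˡ (rest r)) ⟨
    w 0 ℚ.* V 0 r ℚ.+ 1ℚ ℚ.* rest r                        ≡⟨ cong₂ (λ x y → w 0 ℚ.* x ℚ.+ 1ℚ ℚ.* y) (setCol-≡ q _ A r) (setCol-≡ q _ A r) ⟨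
    w 0 ℚ.* setCol q (V 0) A r q ℚ.+ 1ℚ ℚ.* setCol q rest A r q ∎

mixCols : ℕ → Mat → Mat → Mat
mixCols t A N r s with s <? t
... | yes _ = N r s
... | no  _ = A r s

mixCols-< : ∀ t A N r s → s < t → mixCols t A N r s ≡ N r s
mixCols-< t A N r s s<t with s <? t
... | yes _   = refl
... | no s≮t  = ⊥-elim (s≮t s<t)

mixCols-≮ : ∀ t A N r s → ¬ s < t → mixCols t A N r s ≡ A r s
mixCols-≮ t A N r s s≮t with s <? t
... | yes s<t = ⊥-elim (s≮t s<t)
... | no  _   = refl

module _ (n : ℕ) (A : Mat) (X : ℕ → ℕ → ℚ) (X-lower : ∀ m t → m < t → t < n → X m t ≡ 0ℚ) where

  private
    AX : Mat
    AX r t = ∑ℚ n (λ m → X m t ℚ.* A r m)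

  -- Column t of AX is ∑ₘ X m t · (column m of A): the terms m < t vanish by X-lower, and for
  -- m > t the column m of A is still present, so the determinant has two equal columns.
  det′-mixCols-suc : ∀ t → t < n → det′ n (mixCols (suc t) A AX) ≡ X t t ℚ.* det′ n (mixCols t A AX)
  det′-mixCols-suc t t<n = begin
      det′ n (mixCols (suc t) A AX)
    ≡⟨ det′-cong n (λ r s _ _ → mixCols-suc r s) ⟩
      det′ n (setCol t (λ r → AX r t) (mixCols t A AX))
    ≡⟨ det′-∑-col n n t t<n (mixCols t A AX) (λ m → X m t) (λ m r → A r m) ⟩
      ∑ℚ n (λ m → X m t ℚ.* det′ n (setCol t (λ r → A r m) (mixCols t A AX)))
    ≡⟨ Sumℚ.fold-single n t (λ m → X m t ℚ.* det′ n (colReplaced m)) t<n other-terms ⟩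
      X t t ℚ.* det′ n (setCol t (λ r → A r t) (mixCols t A AX))
    ≡⟨ cong (X t t ℚ.*_) (det′-cong n (λ r s _ _ → setCol-own r s)) ⟩
      X t t ℚ.* det′ n (mixCols t A AX)
    ∎
    where
    open ≡-Reasoning
    colReplaced : ℕ → Mat
    colReplaced m = setCol t (λ r → A r m) (mixCols t A AX)
    mixCols-suc : ∀ r s → mixCols (suc t) A AX r s ≡ setCol t (λ r → AX r t) (mixCols t A AX) r s
    mixCols-suc r s with s ≟ t
    ... | yes refl = mixCols-< (suc s) A AX r s ℕ.≤-refl
    ... | no s≢t with s <? t
    ...   | yes s<t = mixCols-< (suc t) A AX r s (ℕ.m<n⇒m<1+n s<t)
    ...   | no s≮t  = mixCols-≮ (suc t) A AX r s (λ s<st → s≮t (ℕ.≤∧≢⇒< (ℕ.≤-pred s<st) s≢t))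
    setCol-own : ∀ r s → setCol t (λ r → A r t) (mixCols t A AX) r s ≡ mixCols t A AX r s
    setCol-own r s with s ≟ t
    ... | yes refl = sym (mixCols-≮ s A AX r s (ℕ.<-irrefl refl))
    ... | no  _    = refl
    other-terms : ∀ m → m < n → m ≢ t → X m t ℚ.* det′ n (colReplaced m) ≡ 0ℚ
    other-terms m m<n m≢t with ℕ.<-cmp m t
    ... | tri< m<t _ _ = trans (cong (ℚ._* det′ n (colReplaced m)) (X-lower m t m<t t<n))
                               (ℚ.*-zeroˡ (det′ n (colReplaced m)))
    ... | tri≈ _ m≡t _ = ⊥-elim (m≢t m≡t)
    ... | tri> _ _ t<m = trans (cong (X m t ℚ.*_) (det′-equal-cols n (colReplaced m) t m t<m m<n cols-t-m))
                               (ℚ.*-zeroʳ (X m t))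
      where
      cols-t-m : ∀ r → colReplaced m r t ≡ colReplaced m r m
      cols-t-m r = trans (setCol-≡ t (λ r → A r m) (mixCols t A AX) r)
        (sym (trans (setCol-≢ t (λ r → A r m) (mixCols t A AX) r m m≢t) (mixCols-≮ t A AX r m (ℕ.<⇒≯ t<m))))

  det′-mixCols : ∀ t → t ≤ n → det′ n (mixCols t A AX) ≡ ∏ℚ t (λ s → X s s) ℚ.* det′ n A
  det′-mixCols zero    _    =
    trans (det′-cong n (λ r s _ _ → mixCols-≮ 0 A AX r s (λ ()))) (sym (ℚ.*-identityˡ _))
  det′-mixCols (suc t) t<n = begin
      det′ n (mixCols (suc t) A AX)
    ≡⟨ det′-mixCols-suc t t<n ⟩
      X t t ℚ.* det′ n (mixCols t A AX)
    ≡⟨ cong (X t t ℚ.*_) (det′-mixCols t (ℕ.<⇒≤ t<n)) ⟩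
      X t t ℚ.* (∏ℚ t diagonal ℚ.* det′ n A)
    ≡⟨ solve 3 (λ x p d → x :* (p :* d) := (p :* x) :* d) refl (X t t) (∏ℚ t diagonal) (det′ n A) ⟩
      (∏ℚ t diagonal ℚ.* X t t) ℚ.* det′ n A
    ≡⟨ cong (ℚ._* det′ n A) (Prodℚ.fold-init-last t diagonal) ⟨
      ∏ℚ (suc t) diagonal ℚ.* det′ n A
    ∎
    where
    open ≡-Reasoning
    diagonal : ℕ → ℚ
    diagonal s = X s s

  det′-mul-lowerTriangular : det′ n (λ r t → ∑ℚ n (λ m → X m t ℚ.* A r m)) ≡ ∏ℚ n (λ t → X t t) ℚ.* det′ n A
  det′-mul-lowerTriangular =
    trans (det′-cong n (λ r s _ s<n → sym (mixCols-< n A AX r s s<n))) (det′-mixCols n ℕ.≤-refl)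

laplaceTerm-zero-entry : ∀ n A j → A 0 j ≡ 0ℚ → laplaceTerm n A j ≡ 0ℚ
laplaceTerm-zero-entry n A j A0j≡0 =
  trans (cong (λ x → negOnePow j ℚ.* (x ℚ.* det′ n (minor j A))) A0j≡0)
    (solve 2 (λ σ d → σ :* (con 0ℚ :* d) := con 0ℚ) refl (negOnePow j) (det′ n (minor j A)))

laplaceTerm-zero-minor : ∀ n A j → det′ n (minor j A) ≡ 0ℚ → laplaceTerm n A j ≡ 0ℚ
laplaceTerm-zero-minor n A j minor≡0 =
  trans (cong (λ x → negOnePow j ℚ.* (A 0 j ℚ.* x)) minor≡0)
    (solve 2 (λ σ a → σ :* (a :* con 0ℚ) := con 0ℚ) refl (negOnePow j) (A 0 j))

det′-zero-row : ∀ n (A : Mat) r → r < n → (∀ s → s < n → A r s ≡ 0ℚ) → det′ n A ≡ 0ℚ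
det′-zero-row (suc n) A zero    _         row≡0 =
  Sumℚ.fold-ε (suc n) (λ j j<n → laplaceTerm-zero-entry n A j (row≡0 j j<n))
det′-zero-row (suc n) A (suc r) (s≤s r<n) row≡0 =
  Sumℚ.fold-ε (suc n) (λ j _ → laplaceTerm-zero-minor n A j
    (det′-zero-row n (minor j A) r r<n (λ s s<n → row≡0 (punchInℕ j s) (punchInℕ-< j s s<n))))

det′-scale-rows : ∀ n (μ : ℕ → ℚ) (A : Mat) → det′ n (λ r s → μ r ℚ.* A r s) ≡ ∏ℚ n μ ℚ.* det′ n A
det′-scale-rows zero    μ A = refl
det′-scale-rows (suc n) μ A =
  trans (Sumℚ.fold-cong (suc n) (λ j _ → term j))
    (*-distribˡ-∑ℚ (suc n) (∏ℚ (suc n) μ) (laplaceTerm n A))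
  where
  term : ∀ j → laplaceTerm n (λ r s → μ r ℚ.* A r s) j ≡ ∏ℚ (suc n) μ ℚ.* laplaceTerm n A j
  term j = trans (cong (λ x → negOnePow j ℚ.* (μ 0 ℚ.* A 0 j ℚ.* x)) (det′-scale-rows n (μ ∘ suc) (minor j A)))
    (solve 5 (λ σ m a p d → σ :* (m :* a :* (p :* d)) := (m :* p) :* (σ :* (a :* d))) refl
       (negOnePow j) (μ 0) (A 0 j) (∏ℚ n (μ ∘ suc)) (det′ n (minor j A)))

det′-scale-cols : ∀ n (ν : ℕ → ℚ) (A : Mat) → det′ n (λ r s → ν s ℚ.* A r s) ≡ ∏ℚ n ν ℚ.* det′ n A
det′-scale-cols zero    ν A = refl
det′-scale-cols (suc n) ν A =
  trans (Sumℚ.fold-cong (suc n) term) (*-distribˡ-∑ℚ (suc n) (∏ℚ (suc n) ν) (laplaceTerm n A))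
  where
  term : ∀ j → j < suc n → laplaceTerm n (λ r s → ν s ℚ.* A r s) j ≡ ∏ℚ (suc n) ν ℚ.* laplaceTerm n A j
  term j j<n = begin
      negOnePow j ℚ.* (ν j ℚ.* A 0 j ℚ.* det′ n (minor j (λ r s → ν s ℚ.* A r s)))
    ≡⟨ cong (λ x → negOnePow j ℚ.* (ν j ℚ.* A 0 j ℚ.* x)) (det′-scale-cols n (ν ∘ punchInℕ j) (minor j A)) ⟩
      negOnePow j ℚ.* (ν j ℚ.* A 0 j ℚ.* (∏ℚ n (ν ∘ punchInℕ j) ℚ.* det′ n (minor j A)))
    ≡⟨ solve 5 (λ σ m a p d → σ :* (m :* a :* (p :* d)) := (m :* p) :* (σ :* (a :* d))) refl
         (negOnePow j) (ν j) (A 0 j) (∏ℚ n (ν ∘ punchInℕ j)) (det′ n (minor j A)) ⟩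
      (ν j ℚ.* ∏ℚ n (ν ∘ punchInℕ j)) ℚ.* laplaceTerm n A j
    ≡⟨ cong (ℚ._* laplaceTerm n A j) (Prodℚ.fold-remove n j ν (ℕ.≤-pred j<n)) ⟨
      ∏ℚ (suc n) ν ℚ.* laplaceTerm n A j
    ∎
    where open ≡-Reasoning

det′-diagonal : ∀ n (D : Mat) (λs : ℕ → ℚ) → (∀ r → r < n → D r r ≡ λs r) →
  (∀ r s → r < n → s < n → s ≢ r → D r s ≡ 0ℚ) → det′ n D ≡ ∏ℚ n λs
det′-diagonal zero    D λs diag off-diag = refl
det′-diagonal (suc n) D λs diag off-diag = begin
    ∑ℚ (suc n) (laplaceTerm n D)
  ≡⟨ Sumℚ.fold-single (suc n) 0 (laplaceTerm n D) (s≤s z≤n)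
       (λ j j<n j≢0 → laplaceTerm-zero-entry n D j (off-diag 0 j (s≤s z≤n) j<n j≢0)) ⟩
    1ℚ ℚ.* (D 0 0 ℚ.* det′ n (minor 0 D))
  ≡⟨ ℚ.*-identityˡ _ ⟩
    D 0 0 ℚ.* det′ n (minor 0 D)
  ≡⟨ cong₂ ℚ._*_ (diag 0 (s≤s z≤n))
       (det′-diagonal n (minor 0 D) (λs ∘ suc) (λ r r<n → diag (suc r) (s≤s r<n))
         (λ r s r<n s<n s≢r → off-diag (suc r) (suc s) (s≤s r<n) (s≤s s<n) (s≢r ∘ ℕ.suc-injective))) ⟩
    ∏ℚ (suc n) λs
  ∎
  where open ≡-Reasoning

det′-block-lower-diagonal : ∀ p q (D : Mat) (λs : ℕ → ℚ) → (∀ r → r < q → D (p + r) (p + r) ≡ λs r) →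
  (∀ r s → r < q → s < p + q → s ≢ p + r → D (p + r) s ≡ 0ℚ) →
  det′ (p + q) D ≡ ∏ℚ q λs ℚ.* det′ p D
det′-block-lower-diagonal zero q D λs diag off-diag =
  trans (det′-diagonal q D λs diag off-diag) (sym (ℚ.*-identityʳ (∏ℚ q λs)))
det′-block-lower-diagonal (suc p) q D λs diag off-diag = begin
    ∑ℚ (suc p + q) (laplaceTerm (p + q) D)
  ≡⟨ Sumℚ.fold-+ (suc p) q (laplaceTerm (p + q) D) ⟩
    ∑ℚ (suc p) (laplaceTerm (p + q) D) ℚ.+ ∑ℚ q (λ i → laplaceTerm (p + q) D (suc p + i))
  ≡⟨ cong₂ ℚ._+_ (Sumℚ.fold-cong (suc p) left-terms) (Sumℚ.fold-ε q right-terms) ⟩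
    ∑ℚ (suc p) (λ j → ∏ℚ q λs ℚ.* laplaceTerm p D j) ℚ.+ 0ℚ
  ≡⟨ trans (ℚ.+-identityʳ _) (*-distribˡ-∑ℚ (suc p) (∏ℚ q λs) (laplaceTerm p D)) ⟩
    ∏ℚ q λs ℚ.* ∑ℚ (suc p) (laplaceTerm p D)
  ∎
  where
  open ≡-Reasoning
  right-terms : ∀ i → i < q → laplaceTerm (p + q) D (suc p + i) ≡ 0ℚ
  right-terms i i<q = laplaceTerm-zero-minor (p + q) D (suc p + i)
    (det′-zero-row (p + q) (minor (suc p + i) D) (p + i) (ℕ.+-monoʳ-< p i<q)
      (λ s s<n → off-diag i (punchInℕ (suc p + i) s) i<q (punchInℕ-< (suc p + i) s s<n) (punchInℕ-≢ (suc p + i) s)))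
  left-terms : ∀ j → j < suc p → laplaceTerm (p + q) D j ≡ ∏ℚ q λs ℚ.* laplaceTerm p D j
  left-terms j j≤p = trans
    (cong (λ x → negOnePow j ℚ.* (D 0 j ℚ.* x)) (det′-block-lower-diagonal p q (minor j D) λs diag′ off-diag′))
    (solve 4 (λ σ a x d → σ :* (a :* (x :* d)) := x :* (σ :* (a :* d))) refl
       (negOnePow j) (D 0 j) (∏ℚ q λs) (det′ p (minor j D)))
    where
    punchIn-p+r : ∀ r → punchInℕ j (p + r) ≡ suc (p + r)
    punchIn-p+r r = punchInℕ-≥ j (p + r) (ℕ.≤-trans (ℕ.≤-pred j≤p) (ℕ.m≤m+n p r))
    diag′ : ∀ r → r < q → minor j D (p + r) (p + r) ≡ λs r
    diag′ r r<q = trans (cong (D (suc p + r)) (punchIn-p+r r)) (diag r r<q)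
    off-diag′ : ∀ r s → r < q → s < p + q → s ≢ p + r → minor j D (p + r) s ≡ 0ℚ
    off-diag′ r s r<q s<n s≢ = off-diag r (punchInℕ j s) r<q (punchInℕ-< j s s<n)
      (λ eq → s≢ (punchInℕ-injective j s (p + r) (trans eq (sym (punchIn-p+r r)))))

-- Signs and inversions

negOnePow-+ : ∀ a b → negOnePow (a + b) ≡ negOnePow a ℚ.* negOnePow b
negOnePow-+ zero    b = sym (ℚ.*-identityˡ _)
negOnePow-+ (suc a) b = trans (cong ℚ.-_ (negOnePow-+ a b)) (ℚ.neg-distribˡ-* (negOnePow a) (negOnePow b))

negOnePow-+-even : ∀ a b → negOnePow (a + (b + b)) ≡ negOnePow a
negOnePow-+-even a zero    = cong negOnePow (ℕ.+-identityʳ a)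
negOnePow-+-even a (suc b) = begin
  negOnePow (a + (suc b + suc b))  ≡⟨ cong negOnePow (trans (cong (a ℕ.+_) (cong suc (ℕ.+-suc b b)))
        (ℕ.+-suc a (suc (b + b)))) ⟩
  negOnePow (suc (a + suc (b + b))) ≡⟨ cong (negOnePow ∘ suc) (ℕ.+-suc a (b + b)) ⟩
  ℚ.- (ℚ.- negOnePow (a + (b + b))) ≡⟨ solve 1 (λ x → :- (:- x) := x) refl (negOnePow (a + (b + b))) ⟩
  negOnePow (a + (b + b))           ≡⟨ negOnePow-+-even a b ⟩
  negOnePow a                       ∎
  where open ≡-Reasoning

negOnePow-*-self : ∀ a → negOnePow a ℚ.* negOnePow a ≡ 1ℚ
negOnePow-*-self zero    = refl
negOnePow-*-self (suc a) =
  trans (solve 1 (λ x → (:- x) :* (:- x) := x :* x) refl (negOnePow a)) (negOnePow-*-self a)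

negOnePow-*-swap : ∀ a x y → x ≡ negOnePow a ℚ.* y → y ≡ negOnePow a ℚ.* x
negOnePow-*-swap a x y x≡±y = begin
  y                                                  ≡⟨ ℚ.*-identityˡ y ⟨
  1ℚ ℚ.* y                                           ≡⟨ cong (ℚ._* y) (negOnePow-*-self a) ⟨
  (negOnePow a ℚ.* negOnePow a) ℚ.* y                ≡⟨ ℚ.*-assoc (negOnePow a) (negOnePow a) y ⟩
  negOnePow a ℚ.* (negOnePow a ℚ.* y)                ≡⟨ cong (negOnePow a ℚ.*_) x≡±y ⟨
  negOnePow a ℚ.* x                                  ∎
  where open ≡-Reasoning

negOnePow-even-sum : ∀ a b d → a + b ≡ d + d → negOnePow a ≡ negOnePow b
negOnePow-even-sum a b d a+b≡d+d = begin
  negOnePow a                                      ≡⟨ ℚ.*-identityʳ _ ⟨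
  negOnePow a ℚ.* 1ℚ                               ≡⟨ cong (negOnePow a ℚ.*_) (negOnePow-*-self b) ⟨
  negOnePow a ℚ.* (negOnePow b ℚ.* negOnePow b)    ≡⟨ ℚ.*-assoc (negOnePow a) (negOnePow b) (negOnePow b) ⟨
  negOnePow a ℚ.* negOnePow b ℚ.* negOnePow b      ≡⟨ cong (ℚ._* negOnePow b) (negOnePow-+ a b) ⟨
  negOnePow (a + b) ℚ.* negOnePow b                ≡⟨ cong (λ x → negOnePow x ℚ.* negOnePow b) a+b≡d+d ⟩
  negOnePow (d + d) ℚ.* negOnePow b                ≡⟨ cong (ℚ._* negOnePow b) (negOnePow-+-even 0 d) ⟩
  1ℚ ℚ.* negOnePow b                               ≡⟨ ℚ.*-identityˡ _ ⟩
  negOnePow b                                      ∎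
  where open ≡-Reasoning

gtIndℕ : ℕ → ℕ → ℕ
gtIndℕ x y with y <? x
... | yes _ = 1
... | no  _ = 0

gtIndℕ-yes : ∀ x y → y < x → gtIndℕ x y ≡ 1
gtIndℕ-yes x y y<x with y <? x
... | yes _   = refl
... | no y≮x  = ⊥-elim (y≮x y<x)

gtIndℕ-no : ∀ x y → ¬ y < x → gtIndℕ x y ≡ 0
gtIndℕ-no x y y≮x with y <? x
... | yes y<x = ⊥-elim (y≮x y<x)
... | no  _   = refl

gtIndℕ-refl : ∀ x → gtIndℕ x x ≡ 0
gtIndℕ-refl x = gtIndℕ-no x x (ℕ.<-irrefl refl)

gtIndℕ-+-swap : ∀ x y → x ≢ y → gtIndℕ x y + gtIndℕ y x ≡ 1
gtIndℕ-+-swap x y x≢y with ℕ.<-cmp x y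
... | tri< x<y _ _ = cong₂ _+_ (gtIndℕ-no x y (ℕ.<⇒≯ x<y)) (gtIndℕ-yes y x x<y)
... | tri≈ _ x≡y _ = ⊥-elim (x≢y x≡y)
... | tri> _ _ y<x = cong₂ _+_ (gtIndℕ-yes x y y<x) (gtIndℕ-no y x (ℕ.<⇒≯ y<x))

gtIndℕ-punchInℕ : ∀ v x y → gtIndℕ (punchInℕ v x) (punchInℕ v y) ≡ gtIndℕ x y
gtIndℕ-punchInℕ v x y with y <? x
... | yes y<x = gtIndℕ-yes _ _ (punchInℕ-mono-< v y x y<x)
... | no  y≮x = gtIndℕ-no _ _ (y≮x ∘ punchInℕ-cancel-< v y x)

∑ℕ-gtIndℕ : ∀ m j → j ≤ m → ∑ℕ m (gtIndℕ j) ≡ j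
∑ℕ-gtIndℕ m       zero    _         = Sumℕ.fold-ε m (λ i _ → gtIndℕ-no 0 i (λ ()))
∑ℕ-gtIndℕ (suc m) (suc j) (s≤s j≤m) =
  cong₂ _+_ (gtIndℕ-yes (suc j) 0 (s≤s z≤n)) (trans (Sumℕ.fold-cong m (λ i _ → gtIndℕ-suc i)) (∑ℕ-gtIndℕ m j j≤m))
  where
  gtIndℕ-suc : ∀ i → gtIndℕ (suc j) (suc i) ≡ gtIndℕ j i
  gtIndℕ-suc i with i <? j
  ... | yes i<j = gtIndℕ-yes _ _ (s≤s i<j)
  ... | no  i≮j = gtIndℕ-no _ _ (i≮j ∘ ℕ.≤-pred)

ifLess : ℕ → ℕ → ℕ → ℕ
ifLess i j x with i <? j
... | yes _ = x
... | no  _ = 0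

ifLess-yes : ∀ i j x → i < j → ifLess i j x ≡ x
ifLess-yes i j x i<j with i <? j
... | yes _   = refl
... | no i≮j  = ⊥-elim (i≮j i<j)

ifLess-no : ∀ i j x → ¬ i < j → ifLess i j x ≡ 0
ifLess-no i j x i≮j with i <? j
... | yes i<j = ⊥-elim (i≮j i<j)
... | no  _   = refl

isInversion : (ℕ → ℕ) → ℕ → ℕ → ℕ
isInversion π i j = ifLess i j (gtIndℕ (π i) (π j))

inversionsℕ : ℕ → (ℕ → ℕ) → ℕ
inversionsℕ n π = ∑ℕ n (λ i → ∑ℕ n (isInversion π i))

module _ (n : ℕ) (π : ℕ → ℕ) (π-< : ∀ i → i < suc n → π i < suc n)
         (π-inj : ∀ i j → i < suc n → j < suc n → π i ≡ π j → i ≡ j) (j : ℕ) (j<n : j < suc n) where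

  private
    v = π j

    v≤n : v ≤ n
    v≤n = ℕ.≤-pred (π-< j j<n)

    π-punchIn-≢ : ∀ s → s < n → π (punchInℕ j s) ≢ v
    π-punchIn-≢ s s<n eq = punchInℕ-≢ j s (π-inj _ _ (punchInℕ-< j s s<n) j<n eq)

  removeℕ : ℕ → ℕ
  removeℕ s = punchOutℕ v (π (punchInℕ j s))

  punchInℕ-removeℕ : ∀ s → s < n → punchInℕ v (removeℕ s) ≡ π (punchInℕ j s)
  punchInℕ-removeℕ s s<n = punchInℕ-punchOutℕ v _ (π-punchIn-≢ s s<n)

  removeℕ-< : ∀ i → i < n → removeℕ i < n
  removeℕ-< i i<n = punchOutℕ-< v _ v≤n (π-< _ (punchInℕ-< j i i<n)) (π-punchIn-≢ i i<n)

  removeℕ-injective : ∀ i k → i < n → k < n → removeℕ i ≡ removeℕ k → i ≡ k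
  removeℕ-injective i k i<n k<n eq = punchInℕ-injective j i k (π-inj _ _ (punchInℕ-< j i i<n) (punchInℕ-< j k k<n)
    (trans (sym (punchInℕ-removeℕ i i<n)) (trans (cong (punchInℕ v) eq) (punchInℕ-removeℕ k k<n))))

  private
    invsBefore = ∑ℕ (suc n) (λ i → isInversion π i j)
    invsAfter = ∑ℕ (suc n) (isInversion π j)
    smallerBefore = ∑ℕ (suc n) (λ i → ifLess i j (gtIndℕ v (π i)))

    isInversion-punchIn : ∀ i l → i < n → l < n → isInversion π (punchInℕ j i) (punchInℕ j l) ≡ isInversion removeℕ i l
    isInversion-punchIn i l i<n l<n = by-cases (i <? l)
      where
      open ≡-Reasoning
      by-cases : Dec (i < l) → isInversion π (punchInℕ j i) (punchInℕ j l) ≡ isInversion removeℕ i l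
      by-cases (yes i<l) = begin
          isInversion π (punchInℕ j i) (punchInℕ j l)
        ≡⟨ ifLess-yes _ _ _ (punchInℕ-mono-< j i l i<l) ⟩
          gtIndℕ (π (punchInℕ j i)) (π (punchInℕ j l))
        ≡⟨ cong₂ gtIndℕ (punchInℕ-removeℕ i i<n) (punchInℕ-removeℕ l l<n) ⟨
          gtIndℕ (punchInℕ v (removeℕ i)) (punchInℕ v (removeℕ l))
        ≡⟨ gtIndℕ-punchInℕ v (removeℕ i) (removeℕ l) ⟩
          gtIndℕ (removeℕ i) (removeℕ l)
        ≡⟨ ifLess-yes i l _ i<l ⟨
          isInversion removeℕ i l
        ∎
      by-cases (no i≮l) = trans (ifLess-no _ _ _ (i≮l ∘ punchInℕ-cancel-< j i l)) (sym (ifLess-no i l _ i≮l))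

    inversions-remove : inversionsℕ (suc n) π ≡ inversionsℕ n removeℕ + invsBefore + invsAfter
    inversions-remove = begin
        inversionsℕ (suc n) π
      ≡⟨ Sumℕ.fold-remove n j row (ℕ.≤-pred j<n) ⟩
        row j + ∑ℕ n (row ∘ punchInℕ j)
      ≡⟨ cong (row j ℕ.+_)
          (Sumℕ.fold-cong n (λ i _ → Sumℕ.fold-remove n j (isInversion π (punchInℕ j i)) (ℕ.≤-pred j<n))) ⟩
        row j + ∑ℕ n (λ i → isInversion π (punchInℕ j i) j + ∑ℕ n (isInversion π (punchInℕ j i) ∘ punchInℕ j))
      ≡⟨ cong (row j ℕ.+_) (Sumℕ.fold-distrib n _ _) ⟩
        row j + (col + ∑ℕ n (λ i → ∑ℕ n (isInversion π (punchInℕ j i) ∘ punchInℕ j)))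
      ≡⟨ cong (λ x → row j + (col + x))
          (Sumℕ.fold-cong n (λ i i<n → Sumℕ.fold-cong n (λ l l<n → isInversion-punchIn i l i<n l<n))) ⟩
        row j + (col + inversionsℕ n removeℕ)
      ≡⟨ rearrange (row j) col (inversionsℕ n removeℕ) ⟩
        inversionsℕ n removeℕ + (0 + col) + row j
      ≡⟨ cong (λ x → inversionsℕ n removeℕ + (x + col) + row j) (ifLess-no j j _ (ℕ.<-irrefl refl)) ⟨
        inversionsℕ n removeℕ + (isInversion π j j + col) + row j
      ≡⟨ cong (λ x → inversionsℕ n removeℕ + x + row j)
          (Sumℕ.fold-remove n j (λ i → isInversion π i j) (ℕ.≤-pred j<n)) ⟨
        inversionsℕ n removeℕ + invsBefore + invsAfter
      ∎
      where
      open ≡-Reasoning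
      row : ℕ → ℕ
      row i = ∑ℕ (suc n) (isInversion π i)
      col = ∑ℕ n (λ i → isInversion π (punchInℕ j i) j)
      rearrange : ∀ r c i → r + (c + i) ≡ i + (0 + c) + r
      rearrange = solve-∀

    invsBefore+smallerBefore : invsBefore + smallerBefore ≡ j
    invsBefore+smallerBefore =
      trans (sym (Sumℕ.fold-distrib (suc n) (λ i → isInversion π i j) (λ i → ifLess i j (gtIndℕ v (π i)))))
        (trans (Sumℕ.fold-cong (suc n) pointwise) (∑ℕ-gtIndℕ (suc n) j (ℕ.<⇒≤ j<n)))
      where
      pointwise : ∀ i → i < suc n → isInversion π i j + ifLess i j (gtIndℕ v (π i)) ≡ gtIndℕ j i
      pointwise i i<n = by-cases (i <? j)
        where
        by-cases : Dec (i < j) → isInversion π i j + ifLess i j (gtIndℕ v (π i)) ≡ gtIndℕ j i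
        by-cases (yes i<j) = trans (cong₂ _+_ (ifLess-yes i j _ i<j) (ifLess-yes i j _ i<j))
          (trans (gtIndℕ-+-swap (π i) v (λ eq → ℕ.<-irrefl (π-inj i j i<n j<n eq) i<j)) (sym (gtIndℕ-yes j i i<j)))
        by-cases (no i≮j) = trans (cong₂ _+_ (ifLess-no i j _ i≮j) (ifLess-no i j _ i≮j)) (sym (gtIndℕ-no j i i≮j))

    smallerBefore+invsAfter : smallerBefore + invsAfter ≡ v
    smallerBefore+invsAfter = begin
        smallerBefore + invsAfter
      ≡⟨ Sumℕ.fold-distrib (suc n) (λ i → ifLess i j (gtIndℕ v (π i))) (isInversion π j) ⟨
        ∑ℕ (suc n) (λ i → ifLess i j (gtIndℕ v (π i)) + isInversion π j i)
      ≡⟨ Sumℕ.fold-cong (suc n) (λ i _ → pointwise i) ⟩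
        ∑ℕ (suc n) (gtIndℕ v ∘ π)
      ≡⟨ Sumℕ.fold-permute (suc n) π (gtIndℕ v) π-< π-inj ⟩
        ∑ℕ (suc n) (gtIndℕ v)
      ≡⟨ ∑ℕ-gtIndℕ (suc n) v (ℕ.<⇒≤ (π-< j j<n)) ⟩
        v
      ∎
      where
      open ≡-Reasoning
      pointwise : ∀ i → ifLess i j (gtIndℕ v (π i)) + isInversion π j i ≡ gtIndℕ v (π i)
      pointwise i with ℕ.<-cmp i j
      ... | tri< i<j _ _  = trans (cong₂ _+_ (ifLess-yes i j _ i<j) (ifLess-no j i _ (ℕ.<⇒≯ i<j))) (ℕ.+-identityʳ _)
      ... | tri≈ _ refl _ = trans (cong₂ _+_ (ifLess-no i i _ (ℕ.<-irrefl refl)) (ifLess-no i i _ (ℕ.<-irrefl refl)))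
                                  (sym (gtIndℕ-refl v))
      ... | tri> _ _ j<i  = cong₂ _+_ (ifLess-no i j _ (ℕ.<⇒≯ j<i)) (ifLess-yes j i _ j<i)

    -- The inversions through position j have the parity of j + π j.
    inversions+value : inversionsℕ (suc n) π + v ≡ (inversionsℕ n removeℕ + j) + (invsAfter + invsAfter)
    inversions+value = begin
        inversionsℕ (suc n) π + v
      ≡⟨ cong₂ _+_ inversions-remove (sym smallerBefore+invsAfter) ⟩
        (inversionsℕ n removeℕ + invsBefore + invsAfter) + (smallerBefore + invsAfter)
      ≡⟨ rearrange (inversionsℕ n removeℕ) invsBefore invsAfter smallerBefore ⟩
        (inversionsℕ n removeℕ + (invsBefore + smallerBefore)) + (invsAfter + invsAfter)
      ≡⟨ cong (λ x → (inversionsℕ n removeℕ + x) + (invsAfter + invsAfter)) invsBefore+smallerBefore ⟩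
        (inversionsℕ n removeℕ + j) + (invsAfter + invsAfter)
      ∎
      where
      open ≡-Reasoning
      rearrange : ∀ i b a s → (i + b + a) + (s + a) ≡ (i + (b + s)) + (a + a)
      rearrange = solve-∀

  sign-removeℕ : negOnePow j ℚ.* negOnePow (inversionsℕ n removeℕ) ≡ negOnePow (inversionsℕ (suc n) π) ℚ.* negOnePow v
  sign-removeℕ = begin
    negOnePow j ℚ.* negOnePow I′                             ≡⟨ ℚ.*-comm (negOnePow j) (negOnePow I′) ⟩
    negOnePow I′ ℚ.* negOnePow j                             ≡⟨ negOnePow-+ I′ j ⟨
    negOnePow (I′ + j)                                       ≡⟨ negOnePow-+-even (I′ + j) invsAfter ⟨
    negOnePow ((I′ + j) + (invsAfter + invsAfter))           ≡⟨ cong negOnePow inversions+value ⟨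
    negOnePow (I + v)                                        ≡⟨ negOnePow-+ I v ⟩
    negOnePow I ℚ.* negOnePow v                              ∎
    where
    open ≡-Reasoning
    I = inversionsℕ (suc n) π
    I′ = inversionsℕ n removeℕ

det′-permute-cols : ∀ n (π : ℕ → ℕ) → (∀ i → i < n → π i < n) → (∀ i j → i < n → j < n → π i ≡ π j → i ≡ j) →
  ∀ (A : Mat) → det′ n (λ r s → A r (π s)) ≡ negOnePow (inversionsℕ n π) ℚ.* det′ n A
det′-permute-cols zero    π π-< π-inj A = refl
det′-permute-cols (suc n) π π-< π-inj A = begin
    ∑ℚ (suc n) (laplaceTerm n (λ r s → A r (π s)))
  ≡⟨ Sumℚ.fold-cong (suc n) term ⟩
    ∑ℚ (suc n) (λ j → negOnePow (inversionsℕ (suc n) π) ℚ.* laplaceTerm n A (π j))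
  ≡⟨ *-distribˡ-∑ℚ (suc n) (negOnePow (inversionsℕ (suc n) π)) (laplaceTerm n A ∘ π) ⟩
    negOnePow (inversionsℕ (suc n) π) ℚ.* ∑ℚ (suc n) (laplaceTerm n A ∘ π)
  ≡⟨ cong (negOnePow (inversionsℕ (suc n) π) ℚ.*_) (Sumℚ.fold-permute (suc n) π (laplaceTerm n A) π-< π-inj) ⟩
    negOnePow (inversionsℕ (suc n) π) ℚ.* ∑ℚ (suc n) (laplaceTerm n A)
  ∎
  where
  open ≡-Reasoning
  term : ∀ j → j < suc n → laplaceTerm n (λ r s → A r (π s)) j
      ≡ negOnePow (inversionsℕ (suc n) π) ℚ.* laplaceTerm n A (π j)
  term j j<n = begin
      negOnePow j ℚ.* (A 0 v ℚ.* det′ n (minor j (λ r s → A r (π s))))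
    ≡⟨ cong (λ x → negOnePow j ℚ.* (A 0 v ℚ.* x)) minor-permuted ⟩
      negOnePow j ℚ.* (A 0 v ℚ.* (negOnePow (inversionsℕ n π′) ℚ.* det′ n (minor v A)))
    ≡⟨ solve 4 (λ a b x d → a :* (x :* (b :* d)) := (a :* b) :* (x :* d)) refl
         (negOnePow j) (negOnePow (inversionsℕ n π′)) (A 0 v) (det′ n (minor v A)) ⟩
      (negOnePow j ℚ.* negOnePow (inversionsℕ n π′)) ℚ.* (A 0 v ℚ.* det′ n (minor v A))
    ≡⟨ cong (ℚ._* (A 0 v ℚ.* det′ n (minor v A))) (sign-removeℕ n π π-< π-inj j j<n) ⟩
      (negOnePow (inversionsℕ (suc n) π) ℚ.* negOnePow v) ℚ.* (A 0 v ℚ.* det′ n (minor v A))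
    ≡⟨ ℚ.*-assoc (negOnePow (inversionsℕ (suc n) π)) (negOnePow v) (A 0 v ℚ.* det′ n (minor v A)) ⟩
      negOnePow (inversionsℕ (suc n) π) ℚ.* laplaceTerm n A v
    ∎
    where
    v = π j
    π′ = removeℕ n π π-< π-inj j j<n
    minor-permuted : det′ n (minor j (λ r s → A r (π s))) ≡ negOnePow (inversionsℕ n π′) ℚ.* det′ n (minor v A)
    minor-permuted = trans
      (det′-cong n (λ r s _ s<n → cong (A (suc r)) (sym (punchInℕ-removeℕ n π π-< π-inj j j<n s s<n))))
      (det′-permute-cols n π′ (removeℕ-< n π π-< π-inj j j<n) (removeℕ-injective n π π-< π-inj j j<n) (minor v A))

fromℚᵘ-homo-* : ∀ x y → ℚ.fromℚᵘ x ℚ.* ℚ.fromℚᵘ y ≡ ℚ.fromℚᵘ (x ℚᵘ.* y)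
fromℚᵘ-homo-* x y = ℚ.toℚᵘ-injective (ℚᵘ.≃-trans (ℚ.toℚᵘ-homo-* (ℚ.fromℚᵘ x) (ℚ.fromℚᵘ y))
  (ℚᵘ.≃-trans (ℚᵘ.*-cong (ℚ.toℚᵘ-fromℚᵘ x) (ℚ.toℚᵘ-fromℚᵘ y)) (ℚᵘ.≃-sym (ℚ.toℚᵘ-fromℚᵘ (x ℚᵘ.* y)))))

fromℚᵘ-homo-+ : ∀ x y → ℚ.fromℚᵘ x ℚ.+ ℚ.fromℚᵘ y ≡ ℚ.fromℚᵘ (x ℚᵘ.+ y)
fromℚᵘ-homo-+ x y = ℚ.toℚᵘ-injective (ℚᵘ.≃-trans (ℚ.toℚᵘ-homo-+ (ℚ.fromℚᵘ x) (ℚ.fromℚᵘ y))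
  (ℚᵘ.≃-trans (ℚᵘ.+-cong (ℚ.toℚᵘ-fromℚᵘ x) (ℚ.toℚᵘ-fromℚᵘ y)) (ℚᵘ.≃-sym (ℚ.toℚᵘ-fromℚᵘ (x ℚᵘ.+ y)))))

/-cross : ∀ a b c d .{{_ : NonZero b}} .{{_ : NonZero d}} → a * d ≡ c * b → + a / b ≡ + c / d
/-cross a (suc b) c (suc d) ad≡cb = ℚ.fromℚᵘ-cong {mkℚᵘ (+ a) b} {mkℚᵘ (+ c) d}
  (*≡* (trans (sym (ℤ.pos-* a (suc d))) (trans (cong +_ ad≡cb) (ℤ.pos-* c (suc b)))))

/-* : ∀ a b c d .{{_ : NonZero b}} .{{_ : NonZero d}} →
  (+ a / b) ℚ.* (+ c / d) ≡ (+ (a * c) / (b * d)) {{ℕ.m*n≢0 b d}}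
/-* a (suc b) c (suc d) =
  trans (fromℚᵘ-homo-* (mkℚᵘ (+ a) b) (mkℚᵘ (+ c) d)) (ℚ./-cong (sym (ℤ.pos-* a c)) refl)

/-+ : ∀ a b c d .{{_ : NonZero b}} .{{_ : NonZero d}} →
  (+ a / b) ℚ.+ (+ c / d) ≡ (+ (a * d + c * b) / (b * d)) {{ℕ.m*n≢0 b d}}
/-+ a (suc b) c (suc d) = trans (fromℚᵘ-homo-+ (mkℚᵘ (+ a) b) (mkℚᵘ (+ c) d))
  (ℚ./-cong (trans (cong₂ ℤ._+_ (sym (ℤ.pos-* a (suc d))) (sym (ℤ.pos-* c (suc b)))) (sym (ℤ.pos-+ (a * suc d) (c * suc b)))) refl)

ℕtoℚ-+ : ∀ a b → ℕtoℚ (a + b) ≡ ℕtoℚ a ℚ.+ ℕtoℚ b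
ℕtoℚ-+ a b = sym (trans (/-+ a 1 b 1) (cong (λ x → + x / 1) (cong₂ _+_ (ℕ.*-identityʳ a) (ℕ.*-identityʳ b))))

ℕtoℚ-* : ∀ a b → ℕtoℚ (a * b) ≡ ℕtoℚ a ℚ.* ℕtoℚ b
ℕtoℚ-* a b = sym (/-* a 1 b 1)

ℕtoℚ-∑ℕ : ∀ n f → ℕtoℚ (∑ℕ n f) ≡ ∑ℚ n (ℕtoℚ ∘ f)
ℕtoℚ-∑ℕ zero    f = refl
ℕtoℚ-∑ℕ (suc n) f = trans (ℕtoℚ-+ (f 0) _) (cong (ℕtoℚ (f 0) ℚ.+_) (ℕtoℚ-∑ℕ n (f ∘ suc)))

recip : ∀ b .{{_ : NonZero b}} → ℚ
recip b = + 1 / b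

/-as-recip : ∀ a b .{{_ : NonZero b}} → + a / b ≡ ℕtoℚ a ℚ.* recip b
/-as-recip a b = sym (trans (/-* a 1 1 b) (/-cross (a * 1) (1 * b) a b {{ℕ.m*n≢0 1 b}} eq))
  where
  eq : a * 1 * b ≡ a * (1 * b)
  eq = trans (cong (_* b) (ℕ.*-identityʳ a)) (cong (a *_) (sym (ℕ.*-identityˡ b)))

ℕtoℚ-*-recip : ∀ b .{{_ : NonZero b}} → ℕtoℚ b ℚ.* recip b ≡ 1ℚ
ℕtoℚ-*-recip b = trans (/-* b 1 1 b) (/-cross (b * 1) (1 * b) 1 1 {{ℕ.m*n≢0 1 b}} eq)
  where
  eq : b * 1 * 1 ≡ 1 * (1 * b)
  eq = trans (ℕ.*-identityʳ (b * 1)) (trans (ℕ.*-identityʳ b) (sym (trans (ℕ.*-identityˡ (1 * b)) (ℕ.*-identityˡ b))))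

recip-* : ∀ a b .{{_ : NonZero a}} .{{_ : NonZero b}} → recip a ℚ.* recip b ≡ (recip (a * b)) {{ℕ.m*n≢0 a b}}
recip-* a b = /-* 1 a 1 b

recip-factor : ∀ a b c .{{_ : NonZero b}} .{{_ : NonZero c}} → a * b ≡ c → recip b ≡ ℕtoℚ a ℚ.* recip c
recip-factor a b c ab≡c = trans (/-cross 1 b a c (trans (ℕ.*-identityˡ c) (sym ab≡c))) (/-as-recip a c)

invFact : ℕ → ℚ
invFact m = recip (m !) {{m !≢0}}

ℕtoℚ-*-invFact : ∀ m → ℕtoℚ (m !) ℚ.* invFact m ≡ 1ℚ
ℕtoℚ-*-invFact m = ℕtoℚ-*-recip (m !) {{m !≢0}}

C*factorials : ∀ d u → u ≤ d → (d C u) * ((d ∸ u) ! * u !) ≡ d !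
C*factorials d u u≤d = trans (cong₂ _*_ (nCk≡n!/k![n-k]! u≤d) (ℕ.*-comm ((d ∸ u) !) (u !)))
  (m/n*n≡m {d !} {u ! * (d ∸ u) !} {{u !* (d ∸ u) !≢0}} (k![n∸k]!∣n! u≤d))

invFact-∸-* : ∀ d u → u ≤ d → invFact (d ∸ u) ℚ.* invFact u ≡ ℕtoℚ (d C u) ℚ.* invFact d
invFact-∸-* d u u≤d = trans (recip-* ((d ∸ u) !) (u !) {{(d ∸ u) !≢0}} {{u !≢0}})
  (recip-factor (d C u) ((d ∸ u) ! * u !) (d !) {{(d ∸ u) !* u !≢0}} {{d !≢0}} (C*factorials d u u≤d))

-- 1/(x − y)!, and 0 when y > x: the value 1/Γ(x − y + 1).
invFactDiff : ℕ → ℕ → ℚ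
invFactDiff x y with y ≤? x
... | yes _ = invFact (x ∸ y)
... | no  _ = 0ℚ

invFactDiff-≤ : ∀ x y → y ≤ x → invFactDiff x y ≡ invFact (x ∸ y)
invFactDiff-≤ x y y≤x with y ≤? x
... | yes _   = refl
... | no y≰x  = ⊥-elim (y≰x y≤x)

invFactDiff-≰ : ∀ x y → ¬ y ≤ x → invFactDiff x y ≡ 0ℚ
invFactDiff-≰ x y y≰x with y ≤? x
... | yes y≤x = ⊥-elim (y≰x y≤x)
... | no  _   = refl

invFactDiff-self : ∀ t → invFactDiff t t ≡ 1ℚ
invFactDiff-self t = trans (invFactDiff-≤ t t ℕ.≤-refl) (cong invFact (ℕ.n∸n≡0 t))

pow2-ℕ : ∀ n → pow2 n ≡ ℕtoℚ (2 ^ n)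
pow2-ℕ zero    = refl
pow2-ℕ (suc n) = trans (cong (ℕtoℚ 2 ℚ.*_) (pow2-ℕ n)) (sym (ℕtoℚ-* 2 (2 ^ n)))

pow2-+ : ∀ a b → pow2 (a + b) ≡ pow2 a ℚ.* pow2 b
pow2-+ zero    b = sym (ℚ.*-identityˡ _)
pow2-+ (suc a) b = trans (cong (ℕtoℚ 2 ℚ.*_) (pow2-+ a b)) (sym (ℚ.*-assoc (ℕtoℚ 2) (pow2 a) (pow2 b)))

halfPow-+ : ∀ a b → halfPow (a + b) ≡ halfPow a ℚ.* halfPow b
halfPow-+ zero    b = sym (ℚ.*-identityˡ _)
halfPow-+ (suc a) b = trans (cong ((+ 1 / 2) ℚ.*_) (halfPow-+ a b)) (sym (ℚ.*-assoc (+ 1 / 2) (halfPow a) (halfPow b)))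

pow2-*-halfPow : ∀ n → pow2 n ℚ.* halfPow n ≡ 1ℚ
pow2-*-halfPow zero    = refl
pow2-*-halfPow (suc n) =
  trans (solve 4 (λ a h x y → (a :* x) :* (h :* y) := (h :* a) :* (x :* y)) refl (ℕtoℚ 2) (+ 1 / 2) (pow2 n) (halfPow n))
    (cong ((+ 1 / 2) ℚ.* ℕtoℚ 2 ℚ.*_) (pow2-*-halfPow n))

pow2-∸ : ∀ c a → a ≤ c → pow2 (c ∸ a) ≡ pow2 c ℚ.* halfPow a
pow2-∸ c a a≤c = begin
  pow2 (c ∸ a)                             ≡⟨ ℚ.*-identityʳ _ ⟨
  pow2 (c ∸ a) ℚ.* 1ℚ                      ≡⟨ cong (pow2 (c ∸ a) ℚ.*_) (pow2-*-halfPow a) ⟨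
  pow2 (c ∸ a) ℚ.* (pow2 a ℚ.* halfPow a)  ≡⟨ ℚ.*-assoc (pow2 (c ∸ a)) (pow2 a) (halfPow a) ⟨
  pow2 (c ∸ a) ℚ.* pow2 a ℚ.* halfPow a    ≡⟨ cong (ℚ._* halfPow a) (trans (sym (pow2-+ (c ∸ a) a)) (cong pow2 (ℕ.m∸n+n≡m a≤c))) ⟩
  pow2 c ℚ.* halfPow a                     ∎
  where open ≡-Reasoning

halfPow-∸ : ∀ c a → c ≤ a → halfPow (a ∸ c) ≡ pow2 c ℚ.* halfPow a
halfPow-∸ c a c≤a = begin
  halfPow (a ∸ c)                               ≡⟨ ℚ.*-identityˡ _ ⟨
  1ℚ ℚ.* halfPow (a ∸ c)                        ≡⟨ cong (ℚ._* halfPow (a ∸ c)) (pow2-*-halfPow c) ⟨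
  pow2 c ℚ.* halfPow c ℚ.* halfPow (a ∸ c)      ≡⟨ ℚ.*-assoc (pow2 c) (halfPow c) (halfPow (a ∸ c)) ⟩
  pow2 c ℚ.* (halfPow c ℚ.* halfPow (a ∸ c))    ≡⟨ cong (pow2 c ℚ.*_) (trans (sym (halfPow-+ c (a ∸ c))) (cong halfPow (ℕ.m+[n∸m]≡n c≤a))) ⟩
  pow2 c ℚ.* halfPow a                          ∎
  where open ≡-Reasoning

pow2ℤ-diff : ∀ c a → pow2ℤ (+ c ℤ.- + a) ≡ pow2 c ℚ.* halfPow a
pow2ℤ-diff c a with a ≤? c
... | yes a≤c = trans (cong pow2ℤ (trans (ℤ.[+m]-[+n]≡m⊖n c a) (ℤ.⊖-≥ a≤c))) (pow2-∸ c a a≤c)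
... | no  a≰c = trans (cong pow2ℤ (trans (ℤ.[+m]-[+n]≡m⊖n c a) (ℤ.⊖-< c<a)))
                  (trans (pow2ℤ-neg (ℕ.m<n⇒0<n∸m c<a)) (halfPow-∸ c a (ℕ.<⇒≤ c<a)))
  where
  c<a : c < a
  c<a = ℕ.≰⇒> a≰c
  pow2ℤ-neg : ∀ {x} → 0 < x → pow2ℤ (ℤ.- (+ x)) ≡ halfPow x
  pow2ℤ-neg {suc x} _ = refl

-- Binomial sums and convolutions

C-suc : ∀ d → d C suc d ≡ 0
C-suc d = k>n⇒nCk≡0 (ℕ.n<1+n d)

∑-binomial : ∀ d → ∑ℕ (suc d) (d C_) ≡ 2 ^ d
∑-binomial zero    = refl
∑-binomial (suc d) = begin
    1 + ∑ℕ (suc d) (λ u → suc d C suc u)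
  ≡⟨ cong (1 ℕ.+_) (Sumℕ.fold-cong (suc d) (λ u _ → sym (nCk+nC[k+1]≡[n+1]C[k+1] d u))) ⟩
    1 + ∑ℕ (suc d) (λ u → d C u + d C suc u)
  ≡⟨ cong (1 ℕ.+_) (Sumℕ.fold-distrib (suc d) (d C_) (λ u → d C suc u)) ⟩
    1 + (S + S′)
  ≡⟨ trans (cong (1 ℕ.+_) (ℕ.+-comm S S′)) (sym (ℕ.+-assoc 1 S′ S)) ⟩
    (1 + S′) + S
  ≡⟨ cong (ℕ._+ S) (trans (Sumℕ.fold-init-last (suc d) (d C_)) (trans (cong (S ℕ.+_) (C-suc d)) (ℕ.+-identityʳ S))) ⟩
    S + S
  ≡⟨ cong₂ _+_ (∑-binomial d) (trans (∑-binomial d) (sym (ℕ.+-identityʳ (2 ^ d)))) ⟩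
    2 ^ suc d
  ∎
  where
  open ≡-Reasoning
  S = ∑ℕ (suc d) (d C_)
  S′ = ∑ℕ (suc d) (λ u → d C suc u)

∑-alternating-binomial : ∀ d → ∑ℚ (suc (suc d)) (λ u → negOnePow u ℚ.* ℕtoℚ (suc d C u)) ≡ 0ℚ
∑-alternating-binomial d = begin
    a (suc d) 0 ℚ.+ ∑ℚ (suc d) (a (suc d) ∘ suc)
  ≡⟨ cong (1ℚ ℚ.+_) (Sumℚ.fold-cong (suc d) (λ u _ → pascal u)) ⟩
    1ℚ ℚ.+ ∑ℚ (suc d) (λ u → ℚ.- a d u ℚ.+ a d (suc u))
  ≡⟨ cong (1ℚ ℚ.+_) (trans (Sumℚ.fold-distrib (suc d) (ℚ.-_ ∘ a d) (a d ∘ suc))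
      (cong (ℚ._+ S′) (neg-distrib-∑ℚ (suc d) (a d)))) ⟩
    1ℚ ℚ.+ (ℚ.- S ℚ.+ S′)
  ≡⟨ solve 2 (λ S S′ → con 1ℚ :+ (:- S :+ S′) := (con 1ℚ :+ S′) :- S) refl S S′ ⟩
    (1ℚ ℚ.+ S′) ℚ.- S
  ≡⟨ cong (ℚ._- S) shifted ⟩
    S ℚ.- S
  ≡⟨ ℚ.+-inverseʳ S ⟩
    0ℚ
  ∎
  where
  open ≡-Reasoning
  a : ℕ → ℕ → ℚ
  a d u = negOnePow u ℚ.* ℕtoℚ (d C u)
  S = ∑ℚ (suc d) (a d)
  S′ = ∑ℚ (suc d) (a d ∘ suc)
  pascal : ∀ u → a (suc d) (suc u) ≡ ℚ.- a d u ℚ.+ a d (suc u)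
  pascal u = trans (cong (λ x → ℚ.- negOnePow u ℚ.* x)
    (trans (cong ℕtoℚ (sym (nCk+nC[k+1]≡[n+1]C[k+1] d u))) (ℕtoℚ-+ (d C u) (d C suc u))))
    (solve 3 (λ s x y → (:- s) :* (x :+ y) := (:- (s :* x)) :+ ((:- s) :* y)) refl
      (negOnePow u) (ℕtoℚ (d C u)) (ℕtoℚ (d C suc u)))
  shifted : 1ℚ ℚ.+ S′ ≡ S
  shifted = begin
    1ℚ ℚ.+ S′                       ≡⟨ Sumℚ.fold-init-last (suc d) (a d) ⟩
    S ℚ.+ a d (suc d)               ≡⟨ cong (λ x → S ℚ.+ negOnePow (suc d) ℚ.* ℕtoℚ x) (C-suc d) ⟩
    S ℚ.+ negOnePow (suc d) ℚ.* 0ℚ  ≡⟨ trans (cong (S ℚ.+_) (ℚ.*-zeroʳ (negOnePow (suc d)))) (ℚ.+-identityʳ S) ⟩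
    S                               ∎

∑-invFact-pairs : ∀ d → ∑ℚ (suc d) (λ u → invFact (d ∸ u) ℚ.* invFact u) ≡ pow2 d ℚ.* invFact d
∑-invFact-pairs d = begin
    ∑ℚ (suc d) (λ u → invFact (d ∸ u) ℚ.* invFact u)
  ≡⟨ Sumℚ.fold-cong (suc d) (λ u u≤d → invFact-∸-* d u (ℕ.≤-pred u≤d)) ⟩
    ∑ℚ (suc d) (λ u → ℕtoℚ (d C u) ℚ.* invFact d)
  ≡⟨ *-distribʳ-∑ℚ (suc d) (invFact d) (ℕtoℚ ∘ (d C_)) ⟩
    ∑ℚ (suc d) (ℕtoℚ ∘ (d C_)) ℚ.* invFact d
  ≡⟨ cong (ℚ._* invFact d) (trans (sym (ℕtoℚ-∑ℕ (suc d) (d C_))) (trans (cong ℕtoℚ (∑-binomial d)) (sym (pow2-ℕ d)))) ⟩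
    pow2 d ℚ.* invFact d
  ∎
  where open ≡-Reasoning

∑-alternating-invFact-pairs : ∀ d → ∑ℚ (suc (suc d)) (λ u → negOnePow u ℚ.* (invFact (suc d ∸ u) ℚ.* invFact u)) ≡ 0ℚ
∑-alternating-invFact-pairs d = begin
    ∑ℚ (suc (suc d)) (λ u → negOnePow u ℚ.* (invFact (suc d ∸ u) ℚ.* invFact u))
  ≡⟨ Sumℚ.fold-cong (suc (suc d)) (λ u u≤d → trans (cong (negOnePow u ℚ.*_) (invFact-∸-* (suc d) u (ℕ.≤-pred u≤d)))
       (sym (ℚ.*-assoc (negOnePow u) (ℕtoℚ (suc d C u)) (invFact (suc d))))) ⟩
    ∑ℚ (suc (suc d)) (λ u → negOnePow u ℚ.* ℕtoℚ (suc d C u) ℚ.* invFact (suc d))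
  ≡⟨ *-distribʳ-∑ℚ (suc (suc d)) (invFact (suc d)) (λ u → negOnePow u ℚ.* ℕtoℚ (suc d C u)) ⟩
    ∑ℚ (suc (suc d)) (λ u → negOnePow u ℚ.* ℕtoℚ (suc d C u)) ℚ.* invFact (suc d)
  ≡⟨ cong (ℚ._* invFact (suc d)) (∑-alternating-binomial d) ⟩
    0ℚ ℚ.* invFact (suc d)
  ≡⟨ ℚ.*-zeroˡ (invFact (suc d)) ⟩
    0ℚ
  ∎
  where open ≡-Reasoning

∑ℚ-window : ∀ L s w f → s + w ≤ L → (∀ j → j < s → f j ≡ 0ℚ) → (∀ j → s + w ≤ j → f j ≡ 0ℚ) →
  ∑ℚ L f ≡ ∑ℚ w (λ u → f (s + u))
∑ℚ-window L s w f s+w≤L below above = begin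
    ∑ℚ L f
  ≡⟨ cong (λ m → ∑ℚ m f) L≡ ⟨
    ∑ℚ (s + (w + r)) f
  ≡⟨ Sumℚ.fold-+ s (w + r) f ⟩
    ∑ℚ s f ℚ.+ ∑ℚ (w + r) (λ i → f (s + i))
  ≡⟨ cong₂ ℚ._+_ (Sumℚ.fold-ε s below) (Sumℚ.fold-+ w r (λ i → f (s + i))) ⟩
    0ℚ ℚ.+ (∑ℚ w (λ u → f (s + u)) ℚ.+ ∑ℚ r (λ v → f (s + (w + v))))
  ≡⟨ cong (λ x → 0ℚ ℚ.+ (∑ℚ w (λ u → f (s + u)) ℚ.+ x)) (Sumℚ.fold-ε r (λ v _ → above _ (s+w≤ v))) ⟩
    0ℚ ℚ.+ (∑ℚ w (λ u → f (s + u)) ℚ.+ 0ℚ)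
  ≡⟨ trans (ℚ.+-identityˡ _) (ℚ.+-identityʳ _) ⟩
    ∑ℚ w (λ u → f (s + u))
  ∎
  where
  open ≡-Reasoning
  r = L ∸ (s + w)
  L≡ : s + (w + r) ≡ L
  L≡ = trans (sym (ℕ.+-assoc s w r)) (ℕ.m+[n∸m]≡n s+w≤L)
  s+w≤ : ∀ v → s + w ≤ s + (w + v)
  s+w≤ v = subst (s + w ≤_) (ℕ.+-assoc s w v) (ℕ.m≤m+n (s + w) v)

convolution-window : ∀ d t α (g : ℕ → ℚ) →
  ∑ℚ (suc (d + (t + α))) (λ j → g j ℚ.* (invFactDiff (d + (t + α)) (j + α) ℚ.* invFactDiff j t))
    ≡ ∑ℚ (suc d) (λ u → g (t + u) ℚ.* (invFact (d ∸ u) ℚ.* invFact u))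
convolution-window d t α g = trans (∑ℚ-window (suc N) t (suc d) F t+sd≤sN below above) (Sumℚ.fold-cong (suc d) inside)
  where
  N = d + (t + α)
  F : ℕ → ℚ
  F j = g j ℚ.* (invFactDiff N (j + α) ℚ.* invFactDiff j t)
  N≡ : N ≡ (t + d) + α
  N≡ = rearrange d t α
    where
    rearrange : ∀ d t α → d + (t + α) ≡ (t + d) + α
    rearrange = solve-∀
  t+sd≤sN : t + suc d ≤ suc N
  t+sd≤sN = subst (_≤ suc N) (sym (ℕ.+-suc t d)) (s≤s (subst ((t + d) ≤_) (sym N≡) (ℕ.m≤m+n (t + d) α)))
  below : ∀ j → j < t → F j ≡ 0ℚ
  below j j<t = trans (cong (λ x → g j ℚ.* (invFactDiff N (j + α) ℚ.* x)) (invFactDiff-≰ j t (ℕ.<⇒≱ j<t)))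
    (solve 2 (λ a b → a :* (b :* con 0ℚ) := con 0ℚ) refl (g j) (invFactDiff N (j + α)))
  above : ∀ j → t + suc d ≤ j → F j ≡ 0ℚ
  above j t+sd≤j = trans (cong (λ x → g j ℚ.* (x ℚ.* invFactDiff j t)) (invFactDiff-≰ N (j + α) (ℕ.<⇒≱ N<j+α)))
    (solve 2 (λ a b → a :* (con 0ℚ :* b) := con 0ℚ) refl (g j) (invFactDiff j t))
    where
    N<j+α : N < j + α
    N<j+α = subst (_< j + α) (sym N≡) (ℕ.+-monoˡ-< α (subst (_≤ j) (ℕ.+-suc t d) t+sd≤j))
  inside : ∀ u → u < suc d → F (t + u) ≡ g (t + u) ℚ.* (invFact (d ∸ u) ℚ.* invFact u)
  inside u u<sd = cong (g (t + u) ℚ.*_) (cong₂ ℚ._*_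
      (trans (invFactDiff-≤ N (t + u + α) t+u+α≤N) (cong invFact N∸))
      (trans (invFactDiff-≤ (t + u) t (ℕ.m≤m+n t u)) (cong invFact (ℕ.m+n∸m≡n t u))))
    where
    rearrange : ∀ t u α → t + u + α ≡ u + (t + α)
    rearrange = solve-∀
    t+u+α≤N : t + u + α ≤ N
    t+u+α≤N = subst (_≤ N) (sym (rearrange t u α)) (ℕ.+-monoˡ-≤ (t + α) (ℕ.≤-pred u<sd))
    N∸ : N ∸ (t + u + α) ≡ d ∸ u
    N∸ = begin
      N ∸ (t + u + α)            ≡⟨ cong₂ _∸_ (ℕ.+-comm d (t + α)) (trans (rearrange t u α) (ℕ.+-comm u (t + α))) ⟩
      (t + α + d) ∸ (t + α + u)  ≡⟨ ℕ.[m+n]∸[m+o]≡n∸o (t + α) d u ⟩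
      d ∸ u                      ∎
      where open ≡-Reasoning

convolution-empty : ∀ N t α (g : ℕ → ℚ) → N < t + α →
  ∑ℚ (suc N) (λ j → g j ℚ.* (invFactDiff N (j + α) ℚ.* invFactDiff j t)) ≡ 0ℚ
convolution-empty N t α g N<t+α = Sumℚ.fold-ε (suc N) (λ j _ → term j)
  where
  term : ∀ j → g j ℚ.* (invFactDiff N (j + α) ℚ.* invFactDiff j t) ≡ 0ℚ
  term j = by-cases (t ≤? j)
    where
    by-cases : Dec (t ≤ j) → g j ℚ.* (invFactDiff N (j + α) ℚ.* invFactDiff j t) ≡ 0ℚ
    by-cases (yes t≤j) = trans
      (cong (λ x → g j ℚ.* (x ℚ.* invFactDiff j t))
        (invFactDiff-≰ N (j + α) (ℕ.<⇒≱ (ℕ.<-≤-trans N<t+α (ℕ.+-monoˡ-≤ α t≤j)))))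
      (solve 2 (λ a b → a :* (con 0ℚ :* b) := con 0ℚ) refl (g j) (invFactDiff j t))
    by-cases (no t≰j) = trans (cong (λ x → g j ℚ.* (invFactDiff N (j + α) ℚ.* x)) (invFactDiff-≰ j t t≰j))
      (solve 2 (λ a b → a :* (b :* con 0ℚ) := con 0ℚ) refl (g j) (invFactDiff N (j + α)))

invFactDiff-convolution : ∀ N t α →
  ∑ℚ (suc N) (λ j → invFactDiff N (j + α) ℚ.* invFactDiff j t) ≡ pow2 (N ∸ (t + α)) ℚ.* invFactDiff N (t + α)
invFactDiff-convolution N t α = by-cases (t + α ≤? N)
  where
  open ≡-Reasoning
  Conv : ℕ → Set
  Conv M = ∑ℚ (suc M) (λ j → invFactDiff M (j + α) ℚ.* invFactDiff j t) ≡ pow2 (M ∸ (t + α)) ℚ.* invFactDiff M (t + α)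
  excess : ∀ d → Conv (d + (t + α))
  excess d = begin
      ∑ℚ (suc M) (λ j → invFactDiff M (j + α) ℚ.* invFactDiff j t)
    ≡⟨ Sumℚ.fold-cong (suc M) (λ j _ → sym (ℚ.*-identityˡ (invFactDiff M (j + α) ℚ.* invFactDiff j t))) ⟩
      ∑ℚ (suc M) (λ j → 1ℚ ℚ.* (invFactDiff M (j + α) ℚ.* invFactDiff j t))
    ≡⟨ convolution-window d t α (λ _ → 1ℚ) ⟩
      ∑ℚ (suc d) (λ u → 1ℚ ℚ.* (invFact (d ∸ u) ℚ.* invFact u))
    ≡⟨ Sumℚ.fold-cong (suc d) (λ u _ → ℚ.*-identityˡ (invFact (d ∸ u) ℚ.* invFact u)) ⟩
      ∑ℚ (suc d) (λ u → invFact (d ∸ u) ℚ.* invFact u)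
    ≡⟨ ∑-invFact-pairs d ⟩
      pow2 d ℚ.* invFact d
    ≡⟨ cong₂ (λ x y → pow2 x ℚ.* invFact y) (sym d≡) (sym d≡) ⟩
      pow2 (M ∸ (t + α)) ℚ.* invFact (M ∸ (t + α))
    ≡⟨ cong (pow2 (M ∸ (t + α)) ℚ.*_) (invFactDiff-≤ M (t + α) (ℕ.m≤n+m (t + α) d)) ⟨
      pow2 (M ∸ (t + α)) ℚ.* invFactDiff M (t + α)
    ∎
    where
    M = d + (t + α)
    d≡ : M ∸ (t + α) ≡ d
    d≡ = ℕ.m+n∸n≡m d (t + α)
  by-cases : Dec (t + α ≤ N) → Conv N
  by-cases (yes t+α≤N) = subst Conv (ℕ.m∸n+n≡m t+α≤N) (excess (N ∸ (t + α)))
  by-cases (no t+α≰N) = begin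
      ∑ℚ (suc N) (λ j → invFactDiff N (j + α) ℚ.* invFactDiff j t)
    ≡⟨ Sumℚ.fold-cong (suc N) (λ j _ → sym (ℚ.*-identityˡ (invFactDiff N (j + α) ℚ.* invFactDiff j t))) ⟩
      ∑ℚ (suc N) (λ j → 1ℚ ℚ.* (invFactDiff N (j + α) ℚ.* invFactDiff j t))
    ≡⟨ convolution-empty N t α (λ _ → 1ℚ) (ℕ.≰⇒> t+α≰N) ⟩
      0ℚ
    ≡⟨ ℚ.*-zeroʳ (pow2 (N ∸ (t + α))) ⟨
      pow2 (N ∸ (t + α)) ℚ.* 0ℚ
    ≡⟨ cong (pow2 (N ∸ (t + α)) ℚ.*_) (invFactDiff-≰ N (t + α) t+α≰N) ⟨
      pow2 (N ∸ (t + α)) ℚ.* invFactDiff N (t + α)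
    ∎

alternating-convolution-≡ : ∀ N t β → t + β ≡ N →
  ∑ℚ (suc N) (λ j → negOnePow j ℚ.* (invFactDiff N (j + β) ℚ.* invFactDiff j t)) ≡ negOnePow t
alternating-convolution-≡ _ t β refl = begin
    ∑ℚ (suc (t + β)) (λ j → negOnePow j ℚ.* (invFactDiff (t + β) (j + β) ℚ.* invFactDiff j t))
  ≡⟨ convolution-window 0 t β negOnePow ⟩
    negOnePow (t + 0) ℚ.* (1ℚ ℚ.* 1ℚ) ℚ.+ 0ℚ
  ≡⟨ cong (λ x → negOnePow x ℚ.* (1ℚ ℚ.* 1ℚ) ℚ.+ 0ℚ) (ℕ.+-identityʳ t) ⟩
    negOnePow t ℚ.* (1ℚ ℚ.* 1ℚ) ℚ.+ 0ℚ
  ≡⟨ solve 1 (λ x → x :* (con 1ℚ :* con 1ℚ) :+ con 0ℚ := x) refl (negOnePow t) ⟩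
    negOnePow t
  ∎
  where open ≡-Reasoning

alternating-convolution-≢ : ∀ N t β → t + β ≢ N →
  ∑ℚ (suc N) (λ j → negOnePow j ℚ.* (invFactDiff N (j + β) ℚ.* invFactDiff j t)) ≡ 0ℚ
alternating-convolution-≢ N t β t+β≢N with t + β ≤? N
... | no t+β≰N = convolution-empty N t β negOnePow (ℕ.≰⇒> t+β≰N)
... | yes t+β≤N with N ∸ (t + β) | ℕ.m∸n+n≡m t+β≤N
...   | zero  | t+β≡N = ⊥-elim (t+β≢N t+β≡N)
...   | suc d | refl  = begin
    ∑ℚ (suc M) (λ j → negOnePow j ℚ.* (invFactDiff M (j + β) ℚ.* invFactDiff j t))
  ≡⟨ convolution-window (suc d) t β negOnePow ⟩
    ∑ℚ (suc (suc d)) (λ u → negOnePow (t + u) ℚ.* (invFact (suc d ∸ u) ℚ.* invFact u))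
  ≡⟨ Sumℚ.fold-cong (suc (suc d)) (λ u _ → split-sign u) ⟩
    ∑ℚ (suc (suc d)) (λ u → negOnePow t ℚ.* (negOnePow u ℚ.* (invFact (suc d ∸ u) ℚ.* invFact u)))
  ≡⟨ *-distribˡ-∑ℚ (suc (suc d)) (negOnePow t) (λ u → negOnePow u ℚ.* (invFact (suc d ∸ u) ℚ.* invFact u)) ⟩
    negOnePow t ℚ.* ∑ℚ (suc (suc d)) (λ u → negOnePow u ℚ.* (invFact (suc d ∸ u) ℚ.* invFact u))
  ≡⟨ cong (negOnePow t ℚ.*_) (∑-alternating-invFact-pairs d) ⟩
    negOnePow t ℚ.* 0ℚ
  ≡⟨ ℚ.*-zeroʳ (negOnePow t) ⟩
    0ℚ
  ∎
  where
  open ≡-Reasoning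
  M = suc d + (t + β)
  split-sign : ∀ u → negOnePow (t + u) ℚ.* (invFact (suc d ∸ u) ℚ.* invFact u)
                     ≡ negOnePow t ℚ.* (negOnePow u ℚ.* (invFact (suc d ∸ u) ℚ.* invFact u))
  split-sign u = trans (cong (ℚ._* (invFact (suc d ∸ u) ℚ.* invFact u)) (negOnePow-+ t u))
    (ℚ.*-assoc (negOnePow t) (negOnePow u) (invFact (suc d ∸ u) ℚ.* invFact u))

-- Interleaving c and β

gtIndℕ-∸ : ∀ N x y → x ≤ N → y ≤ N → gtIndℕ (N ∸ x) (N ∸ y) ≡ gtIndℕ y x
gtIndℕ-∸ N x y x≤N y≤N = by-cases (x <? y)
  where
  by-cases : Dec (x < y) → gtIndℕ (N ∸ x) (N ∸ y) ≡ gtIndℕ y x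
  by-cases (yes x<y) = trans (gtIndℕ-yes _ _ (ℕ.∸-monoʳ-< x<y y≤N)) (sym (gtIndℕ-yes y x x<y))
  by-cases (no  x≮y) =
    trans (gtIndℕ-no _ _ (λ lt → x≮y (ℕ.≰⇒> (λ y≤x → ℕ.<⇒≱ lt (ℕ.∸-monoʳ-≤ N y≤x))))) (sym (gtIndℕ-no y x x≮y))

ifLess-1 : ∀ i j → ifLess i j 1 ≡ gtIndℕ j i
ifLess-1 i j with ℕ.<-cmp i j
... | tri< i<j _ _   = trans (ifLess-yes i j 1 i<j) (sym (gtIndℕ-yes j i i<j))
... | tri≈ i≮j _ _   = trans (ifLess-no i j 1 i≮j) (sym (gtIndℕ-no j i i≮j))
... | tri> i≮j _ _   = trans (ifLess-no i j 1 i≮j) (sym (gtIndℕ-no j i i≮j))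

∑ℕ-const : ∀ k x → ∑ℕ k (λ _ → x) ≡ k * x
∑ℕ-const zero    x = refl
∑ℕ-const (suc k) x = cong (x ℕ.+_) (∑ℕ-const k x)

∏ℚ-negOnePow : ∀ k f → ∏ℚ k (negOnePow ∘ f) ≡ negOnePow (∑ℕ k f)
∏ℚ-negOnePow zero    f = refl
∏ℚ-negOnePow (suc k) f = trans (cong (negOnePow (f 0) ℚ.*_) (∏ℚ-negOnePow k (f ∘ suc))) (sym (negOnePow-+ (f 0) _))

∑ℕ-pairs : ∀ n → ∑ℕ n (λ i → ∑ℕ n (λ j → ifLess i j 1)) ≡ ∑ℕ n id
∑ℕ-pairs n = trans (Sumℕ.fold-comm n n (λ i j → ifLess i j 1))
  (Sumℕ.fold-cong n (λ j j<n → trans (Sumℕ.fold-cong n (λ i _ → ifLess-1 i j)) (∑ℕ-gtIndℕ n j (ℕ.<⇒≤ j<n))))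

-- N ∸ σ reverses every comparison, so each pair i < j is an inversion of exactly one of σ and N ∸ σ.
inversions-reverse : ∀ n N (σ : ℕ → ℕ) → (∀ i → i < n → σ i ≤ N) → (∀ i j → i < n → j < n → σ i ≡ σ j → i ≡ j) →
  inversionsℕ n (λ i → N ∸ σ i) + inversionsℕ n σ ≡ ∑ℕ n id
inversions-reverse n N σ σ≤N σ-inj = begin
    inversionsℕ n (λ i → N ∸ σ i) + inversionsℕ n σ
  ≡⟨ Sumℕ.fold-distrib n _ _ ⟨
    ∑ℕ n (λ i → ∑ℕ n (isInversion (λ i → N ∸ σ i) i) + ∑ℕ n (isInversion σ i))
  ≡⟨ Sumℕ.fold-cong n (λ i i<n → trans (sym (Sumℕ.fold-distrib n _ _)) (Sumℕ.fold-cong n (λ j j<n → pair i j i<n j<n))) ⟩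
    ∑ℕ n (λ i → ∑ℕ n (λ j → ifLess i j 1))
  ≡⟨ ∑ℕ-pairs n ⟩
    ∑ℕ n id
  ∎
  where
  open ≡-Reasoning
  pair : ∀ i j → i < n → j < n → isInversion (λ i → N ∸ σ i) i j + isInversion σ i j ≡ ifLess i j 1
  pair i j i<n j<n = by-cases (i <? j)
    where
    by-cases : Dec (i < j) → isInversion (λ i → N ∸ σ i) i j + isInversion σ i j ≡ ifLess i j 1
    by-cases (yes i<j) = begin
        isInversion (λ i → N ∸ σ i) i j + isInversion σ i j
      ≡⟨ cong₂ _+_ (ifLess-yes i j _ i<j) (ifLess-yes i j _ i<j) ⟩
        gtIndℕ (N ∸ σ i) (N ∸ σ j) + gtIndℕ (σ i) (σ j)
      ≡⟨ cong (ℕ._+ gtIndℕ (σ i) (σ j)) (gtIndℕ-∸ N (σ i) (σ j) (σ≤N i i<n) (σ≤N j j<n)) ⟩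
        gtIndℕ (σ j) (σ i) + gtIndℕ (σ i) (σ j)
      ≡⟨ gtIndℕ-+-swap (σ j) (σ i) (λ eq → ℕ.<-irrefl (sym (σ-inj j i j<n i<n eq)) i<j) ⟩
        1
      ≡⟨ ifLess-yes i j 1 i<j ⟨
        ifLess i j 1
      ∎
    by-cases (no i≮j) = trans (cong₂ _+_ (ifLess-no i j _ i≮j) (ifLess-no i j _ i≮j)) (sym (ifLess-no i j 1 i≮j))

module Shuffle (k N : ℕ) (N+1≡2k : suc N ≡ k + k) (c β : ℕ → ℕ)
  (c-mono : ∀ s t → s < t → t < k → c s < c t)
  (c-< : ∀ s → s < k → c s < k + k)
  (β-< : ∀ i → i < k → β i < k + k)
  (β-inj : ∀ i j → i < k → j < k → β i ≡ β j → i ≡ j)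
  (c≢β : ∀ s i → s < k → i < k → c s ≢ β i) where

  n = k + k

  σ : ℕ → ℕ
  σ j with j <? k
  ... | yes _ = c j
  ... | no  _ = β (j ∸ k)

  σ-left : ∀ s → s < k → σ s ≡ c s
  σ-left s s<k with s <? k
  ... | yes _  = refl
  ... | no s≮k = ⊥-elim (s≮k s<k)

  σ-right : ∀ i → σ (k + i) ≡ β i
  σ-right i with k + i <? k
  ... | yes k+i<k = ⊥-elim (ℕ.<⇒≱ k+i<k (ℕ.m≤m+n k i))
  ... | no  _     = cong β (ℕ.m+n∸m≡n k i)

  private
    left-or-right : ∀ j → j < n → (j < k) ⊎ (Σ[ i ∈ ℕ ] (i < k × j ≡ k + i))
    left-or-right j j<n with j <? k
    ... | yes j<k = inj₁ j<k
    ... | no  j≮k = inj₂ (j ∸ k , ℕ.+-cancelˡ-< k (j ∸ k) k (subst (_< n) (sym k+[j∸k]≡j) j<n) , sym k+[j∸k]≡j)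
      where
      k+[j∸k]≡j : k + (j ∸ k) ≡ j
      k+[j∸k]≡j = ℕ.m+[n∸m]≡n (ℕ.≮⇒≥ j≮k)

    c-inj : ∀ s t → s < k → t < k → c s ≡ c t → s ≡ t
    c-inj s t s<k t<k eq with ℕ.<-cmp s t
    ... | tri< s<t _ _ = ⊥-elim (ℕ.<-irrefl eq (c-mono s t s<t t<k))
    ... | tri≈ _ s≡t _ = s≡t
    ... | tri> _ _ t<s = ⊥-elim (ℕ.<-irrefl (sym eq) (c-mono t s t<s s<k))

  σ-< : ∀ j → j < n → σ j < n
  σ-< j j<n with left-or-right j j<n
  ... | inj₁ j<k = subst (_< n) (sym (σ-left j j<k)) (c-< j j<k)
  ... | inj₂ (i , i<k , refl) = subst (_< n) (sym (σ-right i)) (β-< i i<k)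

  σ-inj : ∀ i j → i < n → j < n → σ i ≡ σ j → i ≡ j
  σ-inj i j i<n j<n eq with left-or-right i i<n | left-or-right j j<n
  ... | inj₁ i<k | inj₁ j<k = c-inj i j i<k j<k (trans (sym (σ-left i i<k)) (trans eq (σ-left j j<k)))
  ... | inj₁ i<k | inj₂ (j′ , j′<k , refl) = ⊥-elim (c≢β i j′ i<k j′<k
      (trans (sym (σ-left i i<k)) (trans eq (σ-right j′))))
  ... | inj₂ (i′ , i′<k , refl) | inj₁ j<k = ⊥-elim (c≢β j i′ j<k i′<k
      (trans (sym (σ-left j j<k)) (trans (sym eq) (σ-right i′))))
  ... | inj₂ (i′ , i′<k , refl) | inj₂ (j′ , j′<k , refl) =
    cong (k ℕ.+_) (β-inj i′ j′ i′<k j′<k (trans (sym (σ-right i′)) (trans eq (σ-right j′))))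

  σ≤N : ∀ j → j < n → σ j ≤ N
  σ≤N j j<n = ℕ.≤-pred (subst (σ j <_) (sym N+1≡2k) (σ-< j j<n))

  β≤N : ∀ i → i < k → β i ≤ N
  β≤N i i<k = subst (_≤ N) (σ-right i) (σ≤N (k + i) (ℕ.+-monoʳ-< k i<k))

  π : ℕ → ℕ
  π j = N ∸ σ j

  π-< : ∀ j → j < n → π j < n
  π-< j _ = subst (π j <_) N+1≡2k (s≤s (ℕ.m∸n≤m N (σ j)))

  π-inj : ∀ i j → i < n → j < n → π i ≡ π j → i ≡ j
  π-inj i j i<n j<n eq = σ-inj i j i<n j<n
    (trans (sym (ℕ.m∸[m∸n]≡n (σ≤N i i<n))) (trans (cong (N ∸_) eq) (ℕ.m∸[m∸n]≡n (σ≤N j j<n))))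

  module _ {A : Set} {_∙_ : Op₂ A} {ε : A} (isCM : IsCommutativeMonoid _≡_ _∙_ ε) where

    open RangeFold isCM

    fold-shuffle : ∀ f → fold k (f ∘ c) ∙ fold k (f ∘ β) ≡ fold n f
    fold-shuffle f = begin
      fold k (f ∘ c) ∙ fold k (f ∘ β)              ≡⟨ cong₂ _∙_ (fold-cong k (λ s s<k → cong f (sym (σ-left s s<k))))
                                                                (fold-cong k (λ i _ → cong f (sym (σ-right i)))) ⟩
      fold k (f ∘ σ) ∙ fold k (λ i → f (σ (k + i))) ≡⟨ fold-+ k k (f ∘ σ) ⟨
      fold n (f ∘ σ)                               ≡⟨ fold-permute n σ f σ-< σ-inj ⟩
      fold n f                                     ∎
      where open ≡-Reasoning

  -- Among the 2k values of σ exactly c s lie below c s, and s of them are values of c.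
  βs-below-c : ∀ s → s < k → ∑ℕ k (λ j → gtIndℕ (c s) (β j)) + s ≡ c s
  βs-below-c s s<k = begin
      ∑ℕ k (λ j → gtIndℕ (c s) (β j)) + s
    ≡⟨ ℕ.+-comm _ s ⟩
      s + ∑ℕ k (λ j → gtIndℕ (c s) (β j))
    ≡⟨ cong₂ _+_ (sym (trans (Sumℕ.fold-cong k (λ t t<k → trans (cong (gtIndℕ (c s)) (σ-left t t<k)) (compare-c t t<k)))
                              (∑ℕ-gtIndℕ k s (ℕ.<⇒≤ s<k))))
                 (Sumℕ.fold-cong k (λ j _ → cong (gtIndℕ (c s)) (sym (σ-right j)))) ⟩
      ∑ℕ k (λ t → gtIndℕ (c s) (σ t)) + ∑ℕ k (λ j → gtIndℕ (c s) (σ (k + j)))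
    ≡⟨ Sumℕ.fold-+ k k (gtIndℕ (c s) ∘ σ) ⟨
      ∑ℕ n (gtIndℕ (c s) ∘ σ)
    ≡⟨ Sumℕ.fold-permute n σ (gtIndℕ (c s)) σ-< σ-inj ⟩
      ∑ℕ n (gtIndℕ (c s))
    ≡⟨ ∑ℕ-gtIndℕ n (c s) (ℕ.<⇒≤ (c-< s s<k)) ⟩
      c s
    ∎
    where
    open ≡-Reasoning
    compare-c : ∀ t → t < k → gtIndℕ (c s) (c t) ≡ gtIndℕ s t
    compare-c t t<k with ℕ.<-cmp t s
    ... | tri< t<s _ _  = trans (gtIndℕ-yes _ _ (c-mono t s t<s s<k)) (sym (gtIndℕ-yes s t t<s))
    ... | tri≈ _ refl _ = trans (gtIndℕ-refl (c t)) (sym (gtIndℕ-refl t))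
    ... | tri> _ _ s<t  = trans (gtIndℕ-no _ _ (ℕ.<⇒≯ (c-mono s t s<t t<k))) (sym (gtIndℕ-no s t (ℕ.<⇒≯ s<t)))

  inversions-σ : inversionsℕ n σ + ∑ℕ k id ≡ inversionsℕ k β + ∑ℕ k c
  inversions-σ = begin
      inversionsℕ n σ + ∑ℕ k id
    ≡⟨ cong (ℕ._+ ∑ℕ k id) (Sumℕ.fold-+ k k row) ⟩
      (∑ℕ k row + ∑ℕ k (λ i → row (k + i))) + ∑ℕ k id
    ≡⟨ cong₂ (λ x y → (x + y) + ∑ℕ k id) (Sumℕ.fold-cong k row-left) (Sumℕ.fold-cong k row-right) ⟩
      (∑ℕ k Y + inversionsℕ k β) + ∑ℕ k id
    ≡⟨ rearrange (∑ℕ k Y) (inversionsℕ k β) (∑ℕ k id) ⟩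
      inversionsℕ k β + (∑ℕ k Y + ∑ℕ k id)
    ≡⟨ cong (inversionsℕ k β ℕ.+_) (trans (sym (Sumℕ.fold-distrib k Y id)) (Sumℕ.fold-cong k βs-below-c)) ⟩
      inversionsℕ k β + ∑ℕ k c
    ∎
    where
    open ≡-Reasoning
    row : ℕ → ℕ
    row i = ∑ℕ n (isInversion σ i)
    Y : ℕ → ℕ
    Y s = ∑ℕ k (λ j → gtIndℕ (c s) (β j))
    rearrange : ∀ y b s → (y + b) + s ≡ b + (y + s)
    rearrange = solve-∀
    row-left : ∀ s → s < k → row s ≡ Y s
    row-left s s<k = trans (Sumℕ.fold-+ k k (isInversion σ s))
      (trans (cong₂ _+_ (Sumℕ.fold-ε k c-part) (Sumℕ.fold-cong k (λ j _ → β-part j))) (ℕ.+-identityˡ _))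
      where
      c-part : ∀ t → t < k → isInversion σ s t ≡ 0
      c-part t t<k with ℕ.<-cmp s t
      ... | tri< s<t _ _ = trans (ifLess-yes s t _ s<t)
              (trans (cong₂ gtIndℕ (σ-left s s<k) (σ-left t t<k)) (gtIndℕ-no _ _ (ℕ.<⇒≯ (c-mono s t s<t t<k))))
      ... | tri≈ s≮t _ _ = ifLess-no s t _ s≮t
      ... | tri> s≮t _ _ = ifLess-no s t _ s≮t
      β-part : ∀ j → isInversion σ s (k + j) ≡ gtIndℕ (c s) (β j)
      β-part j = trans (ifLess-yes s (k + j) _ (ℕ.<-≤-trans s<k (ℕ.m≤m+n k j))) (cong₂ gtIndℕ (σ-left s s<k) (σ-right j))
    row-right : ∀ i → i < k → row (k + i) ≡ ∑ℕ k (isInversion β i)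
    row-right i i<k = trans (Sumℕ.fold-+ k k (isInversion σ (k + i)))
      (trans (cong₂ _+_ (Sumℕ.fold-ε k c-part) (Sumℕ.fold-cong k (λ j _ → β-part j))) (ℕ.+-identityˡ _))
      where
      c-part : ∀ t → t < k → isInversion σ (k + i) t ≡ 0
      c-part t t<k = ifLess-no (k + i) t _ (λ k+i<t → ℕ.<⇒≱ (ℕ.<-trans k+i<t t<k) (ℕ.m≤m+n k i))
      β-part : ∀ j → isInversion σ (k + i) (k + j) ≡ isInversion β i j
      β-part j with ℕ.<-cmp i j
      ... | tri< i<j _ _ = trans (ifLess-yes _ _ _ (ℕ.+-monoʳ-< k i<j))
                             (trans (cong₂ gtIndℕ (σ-right i) (σ-right j)) (sym (ifLess-yes i j _ i<j)))
      ... | tri≈ i≮j _ _ = trans (ifLess-no _ _ _ (i≮j ∘ ℕ.+-cancelˡ-< k i j)) (sym (ifLess-no i j _ i≮j))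
      ... | tri> i≮j _ _ = trans (ifLess-no _ _ _ (i≮j ∘ ℕ.+-cancelˡ-< k i j)) (sym (ifLess-no i j _ i≮j))

  ∏-factorials-shuffle : ∏ℚ k (λ s → ℕtoℚ (c s !)) ℚ.* ∏ℚ k (λ i → ℕtoℚ (β i !))
                         ≡ ∏ℚ k (λ l → ℕtoℚ (l !)) ℚ.* ∏ℚ k (λ l → ℕtoℚ ((k + l) !))
  ∏-factorials-shuffle = trans (fold-shuffle ℚ.*-1-isCommutativeMonoid (λ x → ℕtoℚ (x !)))
    (Prodℚ.fold-+ k k (λ x → ℕtoℚ (x !)))

  shuffle-parity : inversionsℕ n π + (∑ℕ k id + k + ∑ℕ k (λ i → N ∸ β i)) + inversionsℕ k β
                   ≡ (∑ℕ k id + k * k) + (∑ℕ k id + k * k)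
  shuffle-parity = ℕ.+-cancelʳ-≡ (Iσ + (Sc + Sb)) _ _ (begin
      (Iπ + (Ss + k + T)) + Iβ + (Iσ + (Sc + Sb))
    ≡⟨ regroup Iπ Iσ Sc Sb Ss T Iβ k ⟩
      (Iπ + Iσ) + (Iβ + Sc) + Ss + (T + Sb) + k
    ≡⟨ cong₂ (λ x y → x + y + Ss + (T + Sb) + k) (inversions-reverse n N σ σ≤N σ-inj) (sym inversions-σ) ⟩
      P + (Iσ + Ss) + Ss + (T + Sb) + k
    ≡⟨ cong (λ x → P + (Iσ + Ss) + Ss + x + k) T+Sb≡kN ⟩
      P + (Iσ + Ss) + Ss + k * N + k
    ≡⟨ trans (ℕ.+-assoc (P + (Iσ + Ss) + Ss) (k * N) k) (cong (P + (Iσ + Ss) + Ss ℕ.+_) kN+k≡kk+kk) ⟩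
      P + (Iσ + Ss) + Ss + (k * k + k * k)
    ≡⟨ regroup′ P Iσ Ss (k * k) ⟩
      (Ss + k * k) + (Ss + k * k) + (Iσ + P)
    ≡⟨ cong (λ x → (Ss + k * k) + (Ss + k * k) + (Iσ + x)) (sym ∑-c+∑-β) ⟩
      (Ss + k * k) + (Ss + k * k) + (Iσ + (Sc + Sb))
    ∎)
    where
    open ≡-Reasoning
    Iπ = inversionsℕ n π
    Iσ = inversionsℕ n σ
    Iβ = inversionsℕ k β
    Sc = ∑ℕ k c
    Sb = ∑ℕ k β
    Ss = ∑ℕ k id
    T = ∑ℕ k (λ i → N ∸ β i)
    P = ∑ℕ n id
    ∑-c+∑-β : Sc + Sb ≡ P
    ∑-c+∑-β = fold-shuffle ℕ.+-0-isCommutativeMonoid id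
    T+Sb≡kN : T + Sb ≡ k * N
    T+Sb≡kN = trans (sym (Sumℕ.fold-distrib k (λ i → N ∸ β i) β))
      (trans (Sumℕ.fold-cong k (λ i i<k → ℕ.m∸n+n≡m (β≤N i i<k))) (∑ℕ-const k N))
    kN+k≡kk+kk : k * N + k ≡ k * k + k * k
    kN+k≡kk+kk = trans (ℕ.+-comm (k * N) k) (trans (sym (ℕ.*-suc k N)) (trans (cong (k *_) N+1≡2k) (ℕ.*-distribˡ-+ k k k)))
    regroup : ∀ I S C B Z T V K → (I + (Z + K + T)) + V + (S + (C + B)) ≡ (I + S) + (V + C) + Z + (T + B) + K
    regroup = solve-∀
    regroup′ : ∀ P S Z Q → P + (S + Z) + Z + (Q + Q) ≡ (Z + Q) + (Z + Q) + (S + P)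
    regroup′ = solve-∀

  sign-shuffle : negOnePow (inversionsℕ n π) ℚ.* ∏ℚ k (λ i → negOnePow (i + 1 + (N ∸ β i)))
      ≡ negOnePow (inversionsℕ k β)
  sign-shuffle = begin
      negOnePow Iπ ℚ.* ∏ℚ k (λ i → negOnePow (i + 1 + (N ∸ β i)))
    ≡⟨ cong (negOnePow Iπ ℚ.*_) (trans (∏ℚ-negOnePow k (λ i → i + 1 + (N ∸ β i))) (cong negOnePow exponent)) ⟩
      negOnePow Iπ ℚ.* negOnePow E
    ≡⟨ negOnePow-+ Iπ E ⟨
      negOnePow (Iπ + E)
    ≡⟨ negOnePow-even-sum (Iπ + E) (inversionsℕ k β) (∑ℕ k id + k * k) shuffle-parity ⟩
      negOnePow (inversionsℕ k β)
    ∎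
    where
    open ≡-Reasoning
    Iπ = inversionsℕ n π
    E = ∑ℕ k id + k + ∑ℕ k (λ i → N ∸ β i)
    exponent : ∑ℕ k (λ i → i + 1 + (N ∸ β i)) ≡ E
    exponent = trans (Sumℕ.fold-distrib k (λ i → i + 1) (λ i → N ∸ β i))
      (cong (ℕ._+ ∑ℕ k (λ i → N ∸ β i)) (trans (Sumℕ.fold-distrib k id (λ _ → 1))
          (cong (∑ℕ k id ℕ.+_) (trans (∑ℕ-const k 1) (ℕ.*-identityʳ k)))))

-- The determinant of M

invFact-∸ : ∀ c a → a ≤ c → invFact (c ∸ a) ≡ ℕtoℚ (c C a) ℚ.* ℕtoℚ (a !) ℚ.* invFact c
invFact-∸ c a a≤c = begin
  invFact (c ∸ a)                                     ≡⟨ ℚ.*-identityʳ _ ⟨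
  invFact (c ∸ a) ℚ.* 1ℚ                              ≡⟨ cong (invFact (c ∸ a) ℚ.*_) (trans (ℚ.*-comm (invFact a) _) (ℕtoℚ-*-invFact a)) ⟨
  invFact (c ∸ a) ℚ.* (invFact a ℚ.* ℕtoℚ (a !))      ≡⟨ ℚ.*-assoc (invFact (c ∸ a)) (invFact a) (ℕtoℚ (a !)) ⟨
  invFact (c ∸ a) ℚ.* invFact a ℚ.* ℕtoℚ (a !)        ≡⟨ cong (ℚ._* ℕtoℚ (a !)) (invFact-∸-* c a a≤c) ⟩
  ℕtoℚ (c C a) ℚ.* invFact c ℚ.* ℕtoℚ (a !)           ≡⟨ solve 3 (λ x y z → x :* y :* z := x :* z :* y) refl (ℕtoℚ (c C a)) (invFact c) (ℕtoℚ (a !)) ⟩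
  ℕtoℚ (c C a) ℚ.* ℕtoℚ (a !) ℚ.* invFact c           ∎
  where open ≡-Reasoning

-- 2^(c − a) / (c − a)! = (2^(−a) a!) (2^c / c!) C(c, a), valid also for a > c where both sides vanish.
pow2-*-invFactDiff : ∀ N c a → c ≤ N →
  pow2 (N ∸ ((N ∸ c) + a)) ℚ.* invFactDiff N ((N ∸ c) + a)
    ≡ (halfPow a ℚ.* ℕtoℚ (a !)) ℚ.* ((pow2 c ℚ.* invFact c) ℚ.* ℕtoℚ (c C a))
pow2-*-invFactDiff N c a c≤N = by-cases (a ≤? c)
  where
  open ≡-Reasoning
  N∸c+c≡N : (N ∸ c) + c ≡ N
  N∸c+c≡N = ℕ.m∸n+n≡m c≤N
  by-cases : Dec (a ≤ c) → pow2 (N ∸ ((N ∸ c) + a)) ℚ.* invFactDiff N ((N ∸ c) + a)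
                          ≡ (halfPow a ℚ.* ℕtoℚ (a !)) ℚ.* ((pow2 c ℚ.* invFact c) ℚ.* ℕtoℚ (c C a))
  by-cases (yes a≤c) = begin
      pow2 (N ∸ ((N ∸ c) + a)) ℚ.* invFactDiff N ((N ∸ c) + a)
    ≡⟨ cong (pow2 (N ∸ ((N ∸ c) + a)) ℚ.*_) (invFactDiff-≤ N _
        (subst ((N ∸ c) + a ≤_) N∸c+c≡N (ℕ.+-monoʳ-≤ (N ∸ c) a≤c))) ⟩
      pow2 (N ∸ ((N ∸ c) + a)) ℚ.* invFact (N ∸ ((N ∸ c) + a))
    ≡⟨ cong (λ x → pow2 x ℚ.* invFact x) (trans (sym (ℕ.∸-+-assoc N (N ∸ c) a)) (cong (_∸ a) (ℕ.m∸[m∸n]≡n c≤N))) ⟩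
      pow2 (c ∸ a) ℚ.* invFact (c ∸ a)
    ≡⟨ cong₂ ℚ._*_ (pow2-∸ c a a≤c) (invFact-∸ c a a≤c) ⟩
      pow2 c ℚ.* halfPow a ℚ.* (ℕtoℚ (c C a) ℚ.* ℕtoℚ (a !) ℚ.* invFact c)
    ≡⟨ solve 5 (λ p h b f i → p :* h :* (b :* f :* i) := (h :* f) :* ((p :* i) :* b)) refl
         (pow2 c) (halfPow a) (ℕtoℚ (c C a)) (ℕtoℚ (a !)) (invFact c) ⟩
      (halfPow a ℚ.* ℕtoℚ (a !)) ℚ.* ((pow2 c ℚ.* invFact c) ℚ.* ℕtoℚ (c C a))
    ∎
  by-cases (no a≰c) = begin
      pow2 (N ∸ ((N ∸ c) + a)) ℚ.* invFactDiff N ((N ∸ c) + a)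
    ≡⟨ cong (pow2 (N ∸ ((N ∸ c) + a)) ℚ.*_) (invFactDiff-≰ N _
        (λ le → a≰c (ℕ.+-cancelˡ-≤ (N ∸ c) a c (subst ((N ∸ c) + a ≤_) (sym N∸c+c≡N) le)))) ⟩
      pow2 (N ∸ ((N ∸ c) + a)) ℚ.* 0ℚ
    ≡⟨ ℚ.*-zeroʳ (pow2 (N ∸ ((N ∸ c) + a))) ⟩
      0ℚ
    ≡⟨ solve 2 (λ x y → x :* (y :* con 0ℚ) := con 0ℚ) refl (halfPow a ℚ.* ℕtoℚ (a !)) (pow2 c ℚ.* invFact c) ⟨
      (halfPow a ℚ.* ℕtoℚ (a !)) ℚ.* ((pow2 c ℚ.* invFact c) ℚ.* 0ℚ)
    ≡⟨ cong (λ x → (halfPow a ℚ.* ℕtoℚ (a !)) ℚ.* ((pow2 c ℚ.* invFact c) ℚ.* ℕtoℚ x)) (k>n⇒nCk≡0 (ℕ.≰⇒> a≰c)) ⟨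
      (halfPow a ℚ.* ℕtoℚ (a !)) ℚ.* ((pow2 c ℚ.* invFact c) ℚ.* ℕtoℚ (c C a))
    ∎

∏ℚ-ℕtoℚ-*-invFact : ∀ k (g : ℕ → ℕ) → ∏ℚ k (λ l → ℕtoℚ (g l !)) ℚ.* ∏ℚ k (invFact ∘ g) ≡ 1ℚ
∏ℚ-ℕtoℚ-*-invFact k g = trans (sym (Prodℚ.fold-distrib k (λ l → ℕtoℚ (g l !)) (invFact ∘ g)))
  (Prodℚ.fold-ε k (λ l _ → ℕtoℚ-*-invFact (g l)))

module Main (k N : ℕ) (N+1≡2k : suc N ≡ k + k) (α β c : ℕ → ℕ)
  (c-mono : ∀ s t → s < t → t < k → c s < c t)
  (c-< : ∀ s → s < k → c s < k + k)
  (β-< : ∀ i → i < k → β i < k + k)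
  (β-inj : ∀ i j → i < k → j < k → β i ≡ β j → i ≡ j)
  (c≢β : ∀ s i → s < k → i < k → c s ≢ β i) where

  open Shuffle k N N+1≡2k c β c-mono c-< β-< β-inj c≢β

  M : Mat
  M r j with r <? k
  ... | yes _ = invFactDiff N (j + α r)
  ... | no  _ = negOnePow ((r ∸ k) + j + 1) ℚ.* invFactDiff N (j + β (r ∸ k))

  M-top : ∀ i j → i < k → M i j ≡ invFactDiff N (j + α i)
  M-top i j i<k with i <? k
  ... | yes _  = refl
  ... | no i≮k = ⊥-elim (i≮k i<k)

  M-bottom : ∀ i j → M (k + i) j ≡ negOnePow (i + j + 1) ℚ.* invFactDiff N (j + β i)
  M-bottom i j with k + i <? k
  ... | yes k+i<k = ⊥-elim (ℕ.<⇒≱ k+i<k (ℕ.m≤m+n k i))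
  ... | no  _     = cong (λ x → negOnePow (x + j + 1) ℚ.* invFactDiff N (j + β x)) (ℕ.m+n∸m≡n k i)

  T : Mat
  T r t = ∑ℚ n (λ m → invFactDiff m t ℚ.* M r m)

  det′-T : det′ n T ≡ det′ n M
  det′-T = begin
    det′ n T                                      ≡⟨ det′-mul-lowerTriangular n M invFactDiff (λ m t m<t _ → invFactDiff-≰ m t (ℕ.<⇒≱ m<t)) ⟩
    ∏ℚ n (λ t → invFactDiff t t) ℚ.* det′ n M      ≡⟨ cong (ℚ._* det′ n M) (Prodℚ.fold-ε n (λ t _ → invFactDiff-self t)) ⟩
    1ℚ ℚ.* det′ n M                               ≡⟨ ℚ.*-identityˡ (det′ n M) ⟩
    det′ n M                                      ∎
    where open ≡-Reasoning

  private
    ∑-n≡∑-N+1 : ∀ f → ∑ℚ n f ≡ ∑ℚ (suc N) f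
    ∑-n≡∑-N+1 f = cong (λ m → ∑ℚ m f) (sym N+1≡2k)

  T-top : ∀ i t → i < k → T i t ≡ pow2 (N ∸ (t + α i)) ℚ.* invFactDiff N (t + α i)
  T-top i t i<k = trans (∑-n≡∑-N+1 _)
    (trans (Sumℚ.fold-cong (suc N) (λ m _ → trans (cong (invFactDiff m t ℚ.*_) (M-top i m i<k)) (ℚ.*-comm (invFactDiff m t) _)))
      (invFactDiff-convolution N t (α i)))

  T-bottom : ∀ i t → T (k + i) t
      ≡ negOnePow (i + 1) ℚ.* ∑ℚ (suc N) (λ m → negOnePow m ℚ.* (invFactDiff N (m + β i) ℚ.* invFactDiff m t))
  T-bottom i t = trans (∑-n≡∑-N+1 _)
    (trans (Sumℚ.fold-cong (suc N) (λ m _ → entry m))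
      (*-distribˡ-∑ℚ (suc N) (negOnePow (i + 1)) (λ m → negOnePow m ℚ.* (invFactDiff N (m + β i) ℚ.* invFactDiff m t))))
    where
    entry : ∀ m → invFactDiff m t ℚ.* M (k + i) m
                  ≡ negOnePow (i + 1) ℚ.* (negOnePow m ℚ.* (invFactDiff N (m + β i) ℚ.* invFactDiff m t))
    entry m = begin
        invFactDiff m t ℚ.* M (k + i) m
      ≡⟨ cong (invFactDiff m t ℚ.*_) (M-bottom i m) ⟩
        invFactDiff m t ℚ.* (negOnePow (i + m + 1) ℚ.* invFactDiff N (m + β i))
      ≡⟨ cong (λ x → invFactDiff m t ℚ.* (negOnePow x ℚ.* invFactDiff N (m + β i))) (i+m+1≡ i m) ⟩
        invFactDiff m t ℚ.* (negOnePow ((i + 1) + m) ℚ.* invFactDiff N (m + β i))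
      ≡⟨ cong (λ x → invFactDiff m t ℚ.* (x ℚ.* invFactDiff N (m + β i))) (negOnePow-+ (i + 1) m) ⟩
        invFactDiff m t ℚ.* ((negOnePow (i + 1) ℚ.* negOnePow m) ℚ.* invFactDiff N (m + β i))
      ≡⟨ solve 4 (λ r a b x → r :* ((a :* b) :* x) := a :* (b :* (x :* r))) refl
           (invFactDiff m t) (negOnePow (i + 1)) (negOnePow m) (invFactDiff N (m + β i)) ⟩
        negOnePow (i + 1) ℚ.* (negOnePow m ℚ.* (invFactDiff N (m + β i) ℚ.* invFactDiff m t))
      ∎
      where
      open ≡-Reasoning
      i+m+1≡ : ∀ i m → i + m + 1 ≡ (i + 1) + m
      i+m+1≡ i m = trans (ℕ.+-assoc i m 1) (trans (cong (i ℕ.+_) (ℕ.+-comm m 1)) (sym (ℕ.+-assoc i 1 m)))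

  -- Permuting the columns by π = N ∸ σ makes row k + i of T vanish except on the diagonal.
  Tπ : Mat
  Tπ r s = T r (π s)

  diagonalSign : ℕ → ℚ
  diagonalSign i = negOnePow (i + 1 + (N ∸ β i))

  Tπ-bottom-diagonal : ∀ i → i < k → Tπ (k + i) (k + i) ≡ diagonalSign i
  Tπ-bottom-diagonal i i<k = begin
      T (k + i) (N ∸ σ (k + i))
    ≡⟨ cong (λ x → T (k + i) (N ∸ x)) (σ-right i) ⟩
      T (k + i) (N ∸ β i)
    ≡⟨ T-bottom i (N ∸ β i) ⟩
      negOnePow (i + 1) ℚ.* ∑ℚ (suc N) (λ m → negOnePow m ℚ.* (invFactDiff N (m + β i) ℚ.* invFactDiff m (N ∸ β i)))
    ≡⟨ cong (negOnePow (i + 1) ℚ.*_) (alternating-convolution-≡ N (N ∸ β i) (β i) (ℕ.m∸n+n≡m (β≤N i i<k))) ⟩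
      negOnePow (i + 1) ℚ.* negOnePow (N ∸ β i)
    ≡⟨ negOnePow-+ (i + 1) (N ∸ β i) ⟨
      diagonalSign i
    ∎
    where open ≡-Reasoning

  Tπ-bottom-off-diagonal : ∀ i s → i < k → s < n → s ≢ k + i → Tπ (k + i) s ≡ 0ℚ
  Tπ-bottom-off-diagonal i s i<k s<n s≢k+i = begin
      T (k + i) (π s)
    ≡⟨ T-bottom i (π s) ⟩
      negOnePow (i + 1) ℚ.* ∑ℚ (suc N) (λ m → negOnePow m ℚ.* (invFactDiff N (m + β i) ℚ.* invFactDiff m (π s)))
    ≡⟨ cong (negOnePow (i + 1) ℚ.*_) (alternating-convolution-≢ N (π s) (β i) πs+βi≢N) ⟩
      negOnePow (i + 1) ℚ.* 0ℚ
    ≡⟨ ℚ.*-zeroʳ (negOnePow (i + 1)) ⟩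
      0ℚ
    ∎
    where
    open ≡-Reasoning
    πs+βi≢N : π s + β i ≢ N
    πs+βi≢N eq = s≢k+i (σ-inj s (k + i) s<n (ℕ.+-monoʳ-< k i<k) (trans σs≡βi (sym (σ-right i))))
      where
      σs≡βi : σ s ≡ β i
      σs≡βi = sym (ℕ.+-cancelˡ-≡ (N ∸ σ s) (β i) (σ s) (trans eq (sym (ℕ.m∸n+n≡m (σ≤N s s<n)))))

  binomialMatrix : Mat
  binomialMatrix i s = ℕtoℚ (c s C α i)

  rowScale colScale : ℕ → ℚ
  rowScale i = halfPow (α i) ℚ.* ℕtoℚ (α i !)
  colScale s = pow2 (c s) ℚ.* invFact (c s)

  det′-Tπ-top : det′ k Tπ ≡ ∏ℚ k rowScale ℚ.* (∏ℚ k colScale ℚ.* det′ k binomialMatrix)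
  det′-Tπ-top = begin
      det′ k Tπ
    ≡⟨ det′-cong k (λ i s i<k s<k → trans (T-top i (π s) i<k) (entry i s s<k)) ⟩
      det′ k (λ i s → rowScale i ℚ.* (colScale s ℚ.* binomialMatrix i s))
    ≡⟨ det′-scale-rows k rowScale (λ i s → colScale s ℚ.* binomialMatrix i s) ⟩
      ∏ℚ k rowScale ℚ.* det′ k (λ i s → colScale s ℚ.* binomialMatrix i s)
    ≡⟨ cong (∏ℚ k rowScale ℚ.*_) (det′-scale-cols k colScale binomialMatrix) ⟩
      ∏ℚ k rowScale ℚ.* (∏ℚ k colScale ℚ.* det′ k binomialMatrix)
    ∎
    where
    open ≡-Reasoning
    entry : ∀ i s → s < k → pow2 (N ∸ (π s + α i)) ℚ.* invFactDiff N (π s + α i)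
                             ≡ rowScale i ℚ.* (colScale s ℚ.* binomialMatrix i s)
    entry i s s<k = trans (cong (λ x → pow2 (N ∸ ((N ∸ x) + α i)) ℚ.* invFactDiff N ((N ∸ x) + α i)) (σ-left s s<k))
      (pow2-*-invFactDiff N (c s) (α i) (subst (_≤ N) (σ-left s s<k) (σ≤N s (ℕ.<-≤-trans s<k (ℕ.m≤m+n k k)))))

  scalar : ℕ → ℚ
  scalar l = ℕtoℚ (α l !) ℚ.* ℕtoℚ (β l !) ℚ.* invFact l ℚ.* invFact (k + l) ℚ.* (pow2 (c l) ℚ.* halfPow (α l))

  ∏-invFact-c : ∏ℚ k (invFact ∘ c) ≡ ∏ℚ k (λ l → ℕtoℚ (β l !)) ℚ.* ∏ℚ k invFact ℚ.* ∏ℚ k (λ l → invFact (k + l))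
  ∏-invFact-c = begin
      Pic
    ≡⟨ solve 1 (λ x → x := x :* con 1ℚ :* con 1ℚ) refl Pic ⟩
      Pic ℚ.* 1ℚ ℚ.* 1ℚ
    ≡⟨ cong₂ (λ x y → Pic ℚ.* x ℚ.* y) (∏ℚ-ℕtoℚ-*-invFact k id) (∏ℚ-ℕtoℚ-*-invFact k (k ℕ.+_)) ⟨
      Pic ℚ.* (Pfl ℚ.* Pil) ℚ.* (Pfk ℚ.* Pik)
    ≡⟨ solve 5 (λ a b c d e → a :* (b :* c) :* (d :* e) := a :* (b :* d) :* c :* e) refl Pic Pfl Pil Pfk Pik ⟩
      Pic ℚ.* (Pfl ℚ.* Pfk) ℚ.* Pil ℚ.* Pik
    ≡⟨ cong (λ x → Pic ℚ.* x ℚ.* Pil ℚ.* Pik) ∏-factorials-shuffle ⟨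
      Pic ℚ.* (Pfc ℚ.* Pfb) ℚ.* Pil ℚ.* Pik
    ≡⟨ solve 5 (λ a b c d e → a :* (b :* c) :* d :* e := (b :* a) :* c :* d :* e) refl Pic Pfc Pfb Pil Pik ⟩
      (Pfc ℚ.* Pic) ℚ.* Pfb ℚ.* Pil ℚ.* Pik
    ≡⟨ cong (λ x → x ℚ.* Pfb ℚ.* Pil ℚ.* Pik) (∏ℚ-ℕtoℚ-*-invFact k c) ⟩
      1ℚ ℚ.* Pfb ℚ.* Pil ℚ.* Pik
    ≡⟨ cong (λ x → x ℚ.* Pil ℚ.* Pik) (ℚ.*-identityˡ Pfb) ⟩
      Pfb ℚ.* Pil ℚ.* Pik
    ∎
    where
    open ≡-Reasoning
    Pic = ∏ℚ k (invFact ∘ c)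
    Pfc = ∏ℚ k (λ l → ℕtoℚ (c l !))
    Pfb = ∏ℚ k (λ l → ℕtoℚ (β l !))
    Pfl = ∏ℚ k (λ l → ℕtoℚ (l !))
    Pil = ∏ℚ k invFact
    Pfk = ∏ℚ k (λ l → ℕtoℚ ((k + l) !))
    Pik = ∏ℚ k (λ l → invFact (k + l))

  ∏-rowScale-colScale : ∏ℚ k rowScale ℚ.* ∏ℚ k colScale ≡ ∏ℚ k scalar
  ∏-rowScale-colScale = begin
      ∏ℚ k rowScale ℚ.* ∏ℚ k colScale
    ≡⟨ cong₂ ℚ._*_ (Prodℚ.fold-distrib k (halfPow ∘ α) (λ l → ℕtoℚ (α l !)))
        (Prodℚ.fold-distrib k (pow2 ∘ c) (invFact ∘ c)) ⟩
      (Pha ℚ.* Pfa) ℚ.* (Pc2 ℚ.* ∏ℚ k (invFact ∘ c))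
    ≡⟨ cong (λ x → (Pha ℚ.* Pfa) ℚ.* (Pc2 ℚ.* x)) ∏-invFact-c ⟩
      (Pha ℚ.* Pfa) ℚ.* (Pc2 ℚ.* (Pfb ℚ.* Pil ℚ.* Pik))
    ≡⟨ solve 6 (λ a b c d e f → (a :* b) :* (c :* (d :* e :* f)) := b :* d :* e :* f :* (c :* a)) refl Pha Pfa Pc2 Pfb Pil Pik ⟩
      Pfa ℚ.* Pfb ℚ.* Pil ℚ.* Pik ℚ.* (Pc2 ℚ.* Pha)
    ≡⟨ factors ⟨
      ∏ℚ k scalar
    ∎
    where
    open ≡-Reasoning
    Pha = ∏ℚ k (halfPow ∘ α)
    Pfa = ∏ℚ k (λ l → ℕtoℚ (α l !))
    Pc2 = ∏ℚ k (pow2 ∘ c)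
    Pfb = ∏ℚ k (λ l → ℕtoℚ (β l !))
    Pil = ∏ℚ k invFact
    Pik = ∏ℚ k (λ l → invFact (k + l))
    distrib = Prodℚ.fold-distrib k
    factors : ∏ℚ k scalar ≡ Pfa ℚ.* Pfb ℚ.* Pil ℚ.* Pik ℚ.* (Pc2 ℚ.* Pha)
    factors = trans (distrib _ _)
      (cong₂ ℚ._*_ (trans (distrib _ _) (cong₂ ℚ._*_ (trans (distrib _ _) (cong₂ ℚ._*_ (distrib _ _) refl)) refl)) (distrib _ _))

  det′-M : det′ n M ≡ negOnePow (inversionsℕ k β) ℚ.* (∏ℚ k scalar ℚ.* det′ k binomialMatrix)
  det′-M = begin
      det′ n M
    ≡⟨ det′-T ⟨
      det′ n T
    ≡⟨ negOnePow-*-swap (inversionsℕ n π) (det′ n Tπ) (det′ n T) (det′-permute-cols n π π-< π-inj T) ⟩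
      negOnePow (inversionsℕ n π) ℚ.* det′ n Tπ
    ≡⟨ cong (negOnePow (inversionsℕ n π) ℚ.*_)
         (det′-block-lower-diagonal k k Tπ diagonalSign Tπ-bottom-diagonal Tπ-bottom-off-diagonal) ⟩
      negOnePow (inversionsℕ n π) ℚ.* (∏ℚ k diagonalSign ℚ.* det′ k Tπ)
    ≡⟨ cong (λ x → negOnePow (inversionsℕ n π) ℚ.* (∏ℚ k diagonalSign ℚ.* x)) det′-Tπ-top ⟩
      negOnePow (inversionsℕ n π) ℚ.*
        (∏ℚ k diagonalSign ℚ.* (∏ℚ k rowScale ℚ.* (∏ℚ k colScale ℚ.* det′ k binomialMatrix)))
    ≡⟨ solve 5 (λ s l a g d → s :* (l :* (a :* (g :* d))) := (s :* l) :* ((a :* g) :* d)) refl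
         (negOnePow (inversionsℕ n π)) (∏ℚ k diagonalSign) (∏ℚ k rowScale) (∏ℚ k colScale) (det′ k binomialMatrix) ⟩
      (negOnePow (inversionsℕ n π) ℚ.* ∏ℚ k diagonalSign) ℚ.*
        ((∏ℚ k rowScale ℚ.* ∏ℚ k colScale) ℚ.* det′ k binomialMatrix)
    ≡⟨ cong₂ (λ x y → x ℚ.* (y ℚ.* det′ k binomialMatrix)) sign-shuffle ∏-rowScale-colScale ⟩
      negOnePow (inversionsℕ k β) ℚ.* (∏ℚ k scalar ℚ.* det′ k binomialMatrix)
    ∎
    where open ≡-Reasoning

extend : ∀ {k} → (Fin k → ℕ) → ℕ → ℕ
extend {k} g t with t <? k
... | yes t<k = g (Fin.fromℕ< t<k)
... | no  _   = 0

extend-toℕ : ∀ {k} (g : Fin k → ℕ) (i : Fin k) → extend g (toℕ i) ≡ g i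
extend-toℕ {k} g i with toℕ i <? k
... | yes i<k = cong g (Fin.fromℕ<-toℕ i i<k)
... | no  i≮k = ⊥-elim (i≮k (Fin.toℕ<n i))

extend-fromℕ< : ∀ {k} (g : Fin k → ℕ) t (t<k : t < k) → extend g t ≡ g (Fin.fromℕ< t<k)
extend-fromℕ< {k} g t t<k with t <? k
... | yes t<k′ = cong g (Fin.fromℕ<-cong t t refl t<k′ t<k)
... | no  t≮k  = ⊥-elim (t≮k t<k)

0≤⇒≡∣∣ : ∀ x → + 0 ℤ.≤ x → x ≡ + ∣ x ∣
0≤⇒≡∣∣ (+ n) _ = refl

recipGamma-invFactDiff : ∀ N y → recipGamma (+ suc N ℤ.- + y) ≡ invFactDiff N y
recipGamma-invFactDiff N y = by-cases (y ≤? N)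
  where
  recipGamma-neg : ∀ m → recipGamma (ℤ.- (+ m)) ≡ 0ℚ
  recipGamma-neg zero    = refl
  recipGamma-neg (suc m) = refl
  by-cases : Dec (y ≤ N) → recipGamma (+ suc N ℤ.- + y) ≡ invFactDiff N y
  by-cases (yes y≤N) = trans
    (cong recipGamma (trans (ℤ.[+m]-[+n]≡m⊖n (suc N) y)
      (trans (ℤ.⊖-≥ (ℕ.m≤n⇒m≤1+n y≤N)) (cong +_ (ℕ.+-∸-assoc 1 y≤N)))))
    (sym (invFactDiff-≤ N y y≤N))
  by-cases (no y≰N) = trans
    (cong recipGamma (trans (ℤ.[+m]-[+n]≡m⊖n (suc N) y) (ℤ.⊖-≤ (ℕ.≰⇒> y≰N))))
    (trans (recipGamma-neg (y ∸ suc N)) (sym (invFactDiff-≰ N y y≰N)))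

gtInd-gtIndℕ : ∀ m n → gtInd (+ m) (+ n) ≡ gtIndℕ m n
gtInd-gtIndℕ m n with + n ℤ.<? + m | n <? m
... | yes _   | yes _   = refl
... | no  _   | no  _   = refl
... | yes n<m | no  n≮m = ⊥-elim (n≮m (ℤ.drop‿+<+ n<m))
... | no  n≮m | yes n<m = ⊥-elim (n≮m (ℤ.+<+ n<m))

inversions-extend : ∀ {k} (a : Fin k → ℤ) → (∀ i → + 0 ℤ.≤ a i) → inversions a ≡ inversionsℕ k (extend (∣_∣ ∘ a))
inversions-extend {k} a a≥0 = trans pointwise
  (trans (countFin-cong k (λ i → countFin-toℕ k (isInversion b (toℕ i)))) (countFin-toℕ k (λ i → ∑ℕ k (isInversion b i))))
  where
  b = extend (∣_∣ ∘ a)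
  gtInd-b : ∀ i j → gtInd (a i) (a j) ≡ gtIndℕ (b (toℕ i)) (b (toℕ j))
  gtInd-b i j = trans (cong₂ gtInd (0≤⇒≡∣∣ (a i) (a≥0 i)) (0≤⇒≡∣∣ (a j) (a≥0 j)))
    (trans (gtInd-gtIndℕ ∣ a i ∣ ∣ a j ∣) (sym (cong₂ gtIndℕ (extend-toℕ (∣_∣ ∘ a) i) (extend-toℕ (∣_∣ ∘ a) j))))
  -- The left-hand side of entry is the where-bound indicator of inversions, which cannot be named
  -- here; pointwise fixes it before entry is checked.
  mutual
    pointwise : inversions a ≡ countFin {k} (λ i → countFin {k} (λ j → isInversion b (toℕ i) (toℕ j)))
    pointwise = countFin-cong k (λ i → countFin-cong k (entry i))

    entry : ∀ i j → _ ≡ isInversion b (toℕ i) (toℕ j)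
    entry i j with toℕ i <? toℕ j
    ... | yes _ = gtInd-b i j
    ... | no  _ = refl

module Lemma6Setup (k : ℕ) (1≤k : 1 ℕ.≤ k) (e f : Fin k → ℤ) (c : Fin k → ℕ)
  (e≥0 : ∀ i → + 0 ℤ.≤ shift e i)
  (f≥0 : ∀ i → + 0 ℤ.≤ shift f i)
  (f<2k : ∀ i → shift f i ℤ.< + (2 ℕ.* k))
  (f-inj : ∀ i j → shift f i ≡ shift f j → i ≡ j)
  (c-mono : ∀ i j → i Fin.< j → c i ℕ.< c j)
  (c<2k : ∀ j → c j ℕ.< 2 ℕ.* k)
  (c≢f : ∀ i j → + (c j) ≢ shift f i) where

  N : ℕ
  N = ℕ.pred (k + k)

  N+1≡2k : suc N ≡ k + k
  N+1≡2k = ℕ.suc-pred (k + k) {{ℕ.>-nonZero (ℕ.<-≤-trans 1≤k (ℕ.m≤m+n k k))}}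

  2*k≡k+k : 2 * k ≡ k + k
  2*k≡k+k = cong (λ x → k + x) (ℕ.+-identityʳ k)

  α β c′ : ℕ → ℕ
  α = extend (∣_∣ ∘ shift e)
  β = extend (∣_∣ ∘ shift f)
  c′ = extend c

  private
    fin : ∀ {t} → t < k → Fin k
    fin t<k = Fin.fromℕ< t<k

    toℕ-fin : ∀ {t} (t<k : t < k) → toℕ (fin t<k) ≡ t
    toℕ-fin t<k = Fin.toℕ-fromℕ< t<k

    shift-f≡β : ∀ i → shift f i ≡ + ∣ shift f i ∣
    shift-f≡β i = 0≤⇒≡∣∣ (shift f i) (f≥0 i)

  c′-mono : ∀ s t → s < t → t < k → c′ s < c′ t
  c′-mono s t s<t t<k = subst₂ _<_ (sym (extend-fromℕ< c s s<k)) (sym (extend-fromℕ< c t t<k))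
    (c-mono (fin s<k) (fin t<k) (subst₂ _<_ (sym (toℕ-fin s<k)) (sym (toℕ-fin t<k)) s<t))
    where
    s<k : s < k
    s<k = ℕ.<-trans s<t t<k

  c′-< : ∀ s → s < k → c′ s < k + k
  c′-< s s<k = subst₂ _<_ (sym (extend-fromℕ< c s s<k)) 2*k≡k+k (c<2k (fin s<k))

  β-< : ∀ i → i < k → β i < k + k
  β-< i i<k = subst₂ _<_ (sym (extend-fromℕ< (∣_∣ ∘ shift f) i i<k)) 2*k≡k+k
    (ℤ.drop‿+<+ (subst (ℤ._< + (2 * k)) (shift-f≡β (fin i<k)) (f<2k (fin i<k))))

  β-inj : ∀ i j → i < k → j < k → β i ≡ β j → i ≡ j
  β-inj i j i<k j<k βi≡βj = trans (sym (toℕ-fin i<k)) (trans (cong toℕ (f-inj (fin i<k) (fin j<k) shifts-equal)) (toℕ-fin j<k))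
    where
    shifts-equal : shift f (fin i<k) ≡ shift f (fin j<k)
    shifts-equal = trans (shift-f≡β (fin i<k)) (trans (cong +_ (trans (sym (extend-fromℕ< (∣_∣ ∘ shift f) i i<k))
      (trans βi≡βj (extend-fromℕ< (∣_∣ ∘ shift f) j j<k)))) (sym (shift-f≡β (fin j<k))))

  c′≢β : ∀ s i → s < k → i < k → c′ s ≢ β i
  c′≢β s i s<k i<k c′s≡βi = c≢f (fin i<k) (fin s<k) (trans (cong +_ (trans (sym (extend-fromℕ< c s s<k))
    (trans c′s≡βi (extend-fromℕ< (∣_∣ ∘ shift f) i i<k)))) (sym (shift-f≡β (fin i<k))))

  open Main k N N+1≡2k α β c′ c′-mono c′-< β-< β-inj c′≢β public

  private
    shift-e≡α : ∀ i → shift e i ≡ + ∣ shift e i ∣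
    shift-e≡α i = 0≤⇒≡∣∣ (shift e i) (e≥0 i)

    gammaArgument : ∀ (E : ℤ) a b x → E ℤ.+ + a ≡ + x → + (2 * k) ℤ.- + a ℤ.- + b ℤ.- E ≡ + suc N ℤ.- + (b + x)
    gammaArgument E a b x E+a≡x = trans (regroup (+ (2 * k)) (+ a) (+ b) E)
      (cong₂ (λ u v → + u ℤ.- v) (trans 2*k≡k+k (sym N+1≡2k))
        (trans (cong (λ z → + b ℤ.+ z) E+a≡x) (sym (ℤ.pos-+ b x))))
      where
      regroup : ∀ X a b E → X ℤ.- a ℤ.- b ℤ.- E ≡ X ℤ.- (b ℤ.+ (E ℤ.+ a))
      regroup = ℤ-RingSolver.solve-∀

  matM≡M : ∀ r j → matM k e f r j ≡ M (toℕ r) (toℕ j)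
  matM≡M r j with Fin.splitAt k r in split≡
  ... | inj₁ i = begin
      recipGamma (+ (2 * k) ℤ.- + toℕ i ℤ.- + toℕ j ℤ.- e i)
    ≡⟨ cong recipGamma (gammaArgument (e i) (toℕ i) (toℕ j) ∣ shift e i ∣ (shift-e≡α i)) ⟩
      recipGamma (+ suc N ℤ.- + (toℕ j + ∣ shift e i ∣))
    ≡⟨ recipGamma-invFactDiff N (toℕ j + ∣ shift e i ∣) ⟩
      invFactDiff N (toℕ j + ∣ shift e i ∣)
    ≡⟨ cong (λ x → invFactDiff N (toℕ j + x)) (extend-toℕ (∣_∣ ∘ shift e) i) ⟨
      invFactDiff N (toℕ j + α (toℕ i))
    ≡⟨ M-top (toℕ i) (toℕ j) (Fin.toℕ<n i) ⟨
      M (toℕ i) (toℕ j)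
    ≡⟨ cong (λ x → M x (toℕ j)) (trans (cong toℕ (sym (Fin.splitAt⁻¹-↑ˡ split≡))) (Fin.toℕ-↑ˡ i k)) ⟨
      M (toℕ r) (toℕ j)
    ∎
    where open ≡-Reasoning
  ... | inj₂ i = begin
      negOnePow (toℕ i + toℕ j + 1) ℚ.* recipGamma (+ (2 * k) ℤ.- + toℕ i ℤ.- + toℕ j ℤ.- f i)
    ≡⟨ cong (negOnePow (toℕ i + toℕ j + 1) ℚ.*_)
        (cong recipGamma (gammaArgument (f i) (toℕ i) (toℕ j) ∣ shift f i ∣ (shift-f≡β i))) ⟩
      negOnePow (toℕ i + toℕ j + 1) ℚ.* recipGamma (+ suc N ℤ.- + (toℕ j + ∣ shift f i ∣))
    ≡⟨ cong (negOnePow (toℕ i + toℕ j + 1) ℚ.*_) (recipGamma-invFactDiff N (toℕ j + ∣ shift f i ∣)) ⟩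
      negOnePow (toℕ i + toℕ j + 1) ℚ.* invFactDiff N (toℕ j + ∣ shift f i ∣)
    ≡⟨ cong (λ x → negOnePow (toℕ i + toℕ j + 1) ℚ.* invFactDiff N (toℕ j + x)) (extend-toℕ (∣_∣ ∘ shift f) i) ⟨
      negOnePow (toℕ i + toℕ j + 1) ℚ.* invFactDiff N (toℕ j + β (toℕ i))
    ≡⟨ M-bottom (toℕ i) (toℕ j) ⟨
      M (k + toℕ i) (toℕ j)
    ≡⟨ cong (λ x → M x (toℕ j)) (trans (cong toℕ (sym (Fin.splitAt⁻¹-↑ʳ split≡))) (Fin.toℕ-↑ʳ k i)) ⟨
      M (toℕ r) (toℕ j)
    ∎
    where open ≡-Reasoning

  det-matM : det (matM k e f) ≡ det′ (k + k) M
  det-matM = trans (det-cong (k + k) matM≡M) (det-toℕ (k + k) M)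

  sgnSeq-shift-f : sgnSeq (shift f) ≡ negOnePow (inversionsℕ k β)
  sgnSeq-shift-f = cong negOnePow (inversions-extend (shift f) f≥0)

  det-binomial : det (λ i j → ℕtoℚ (c j C ∣ shift e i ∣)) ≡ det′ k binomialMatrix
  det-binomial = trans
    (det-cong k (λ i j → cong₂ (λ u v → ℕtoℚ (u C v)) (sym (extend-toℕ c j)) (sym (extend-toℕ (∣_∣ ∘ shift e) i))))
    (det-toℕ k binomialMatrix)

  productFactor : Fin k → ℚ
  productFactor l = (_/_ (+ ((∣ shift e l ∣ !) ℕ.* (∣ shift f l ∣ !))) ((toℕ l !) ℕ.* ((k ℕ.+ toℕ l) !))
          {{(toℕ l) !* (k ℕ.+ toℕ l) !≢0}})
        ℚ.* pow2ℤ (+ (c l) ℤ.- shift e l)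

  prodFin-scalar : prodFin productFactor ≡ ∏ℚ k scalar
  prodFin-scalar = trans (prodFin-cong k factor) (prodFin-toℕ k scalar)
    where
    factor : ∀ l → productFactor l ≡ scalar (toℕ l)
    factor l = begin
        (+ (A * B) / (X * Y)) {{toℕ l !* (k + toℕ l) !≢0}} ℚ.* pow2ℤ (+ (c l) ℤ.- shift e l)
      ≡⟨ cong₂ ℚ._*_ (/-as-recip (A * B) (X * Y) {{toℕ l !* (k + toℕ l) !≢0}})
                     (trans (cong (λ z → pow2ℤ (+ (c l) ℤ.- z)) (shift-e≡α l)) (pow2ℤ-diff (c l) a)) ⟩
        ℕtoℚ (A * B) ℚ.* recip (X * Y) {{toℕ l !* (k + toℕ l) !≢0}} ℚ.* (pow2 (c l) ℚ.* halfPow a)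
      ≡⟨ cong₂ (λ u v → u ℚ.* v ℚ.* (pow2 (c l) ℚ.* halfPow a)) (ℕtoℚ-* A B)
          (sym (recip-* X Y {{toℕ l !≢0}} {{(k + toℕ l) !≢0}})) ⟩
        ℕtoℚ A ℚ.* ℕtoℚ B ℚ.* (invFact (toℕ l) ℚ.* invFact (k + toℕ l)) ℚ.* (pow2 (c l) ℚ.* halfPow a)
      ≡⟨ cong (ℚ._* (pow2 (c l) ℚ.* halfPow a))
          (ℚ.*-assoc (ℕtoℚ A ℚ.* ℕtoℚ B) (invFact (toℕ l)) (invFact (k + toℕ l))) ⟨
        ℕtoℚ A ℚ.* ℕtoℚ B ℚ.* invFact (toℕ l) ℚ.* invFact (k + toℕ l) ℚ.* (pow2 (c l) ℚ.* halfPow a)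
      ≡⟨ cong₃ (λ u v w → ℕtoℚ (u !) ℚ.* ℕtoℚ (v !) ℚ.* invFact (toℕ l) ℚ.* invFact (k + toℕ l) ℚ.* (pow2 w ℚ.* halfPow u))
           (extend-toℕ (∣_∣ ∘ shift e) l) (extend-toℕ (∣_∣ ∘ shift f) l) (extend-toℕ c l) ⟨
        scalar (toℕ l)
      ∎
      where
      open ≡-Reasoning
      a = ∣ shift e l ∣
      A = a !
      B = ∣ shift f l ∣ !
      X = toℕ l !
      Y = (k + toℕ l) !
      cong₃ : ∀ {x y z x′ y′ z′ : ℕ} (h : ℕ → ℕ → ℕ → ℚ) → x ≡ x′ → y ≡ y′ → z ≡ z′ → h x y z ≡ h x′ y′ z′
      cong₃ h refl refl refl = refl

lemma6 : (k : ℕ) → 1 ℕ.≤ k →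
    (e f : Fin k → ℤ) → (c : Fin k → ℕ) →
    (∀ i → + 0 ℤ.≤ shift e i) →
    (∀ i j → shift e i ≡ shift e j → i ≡ j) →
    (∀ i → + 0 ℤ.≤ shift f i) →
    (∀ i → shift f i ℤ.< + (2 ℕ.* k)) →
    (∀ i j → shift f i ≡ shift f j → i ≡ j) →
    (∀ i j → i Fin.< j → c i ℕ.< c j) →
    (∀ j → c j ℕ.< 2 ℕ.* k) →
    (∀ i j → + (c j) ≢ shift f i) →
    det (matM k e f)
      ≡ sgnSeq (shift f) ℚ.*
        (prodFin (λ l →
           (_/_ (+ ((∣ shift e l ∣ !) ℕ.* (∣ shift f l ∣ !))) ((toℕ l !) ℕ.* ((k ℕ.+ toℕ l) !))
              {{(toℕ l) !* (k ℕ.+ toℕ l) !≢0}})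
           ℚ.* pow2ℤ (+ (c l) ℤ.- shift e l))
         ℚ.* det (λ i j → ℕtoℚ (c j C ∣ shift e i ∣)))
lemma6 k 1≤k e f c e≥0 _ f≥0 f<2k f-inj c-mono c<2k c≢f = begin
    det (matM k e f)
  ≡⟨ det-matM ⟩
    det′ (k + k) M
  ≡⟨ det′-M ⟩
    negOnePow (inversionsℕ k β) ℚ.* (∏ℚ k scalar ℚ.* det′ k binomialMatrix)
  ≡⟨ cong₂ ℚ._*_ sgnSeq-shift-f (cong₂ ℚ._*_ prodFin-scalar det-binomial) ⟨
    sgnSeq (shift f) ℚ.* (prodFin productFactor ℚ.* det (λ i j → ℕtoℚ (c j C ∣ shift e i ∣)))
  ∎
  where
  open ≡-Reasoning
  open Lemma6Setup k 1≤k e f c e≥0 f≥0 f<2k f-inj c-mono c<2k c≢f
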